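{- Let $a,b\ge1$, $n=a+b$, $P=[a]\times[b]$, and let $f:\hat P\to\mathbb{R}^+$ with $f(\hat 0)=f(\hat 1)=1$. For all $1\le i\le n-1$, $Q(\phi_i^* f)=\sigma_i Q(f)$; that is, toggling the $i$-th file of $f$ swaps the $i$-th and $(i+1)$-st entries of the quotient sequence of $f$.
   Context: $[a]\times[b]$ is ordered componentwise; $\hat P$ is $P$ with new minimum $\hat 0$ and maximum $\hat 1$; $\lessdot$ is the covering relation in $\hat P$. The $i$-th file of $P$ ($1\le i\le n-1$) is $\{(i',j)\in P: j-i'+a=i\}$. For $x\in P$ the birational toggle $\phi_x$ changes only the value at $x$: $(\phi_x f)(x)=LR/f(x)$ with $L=\sum_{y\in\hat P,\,y\lessdot x} f(y)$ and $R$ the parallel sum of $\{f(y):y\in\hat P,\ y\gtrdot x\}$, where the parallel sum of $s_1,\dots,s_m$ is $1/(1/s_1+\cdots+1/s_m)$. $\phi_i^*$ is the product of the (commuting) toggles $\phi_x$ over all $x$ in the $i$-th file. Let $p_i$ be the product of $f(x)$ over $x$ in the $i$-th file ($1\le i\le n-1$), $p_0=p_n=1$, $q_i=p_i/p_{i-1}$ for $1\le i\le n$; the quotient sequence is $Q(f)=(q_1,\dots,q_n)$. $\sigma_i$ swaps the $i$-th and $(i+1)$-st entries of a length-$n$ sequence. -}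

module Defs where

open import Level using (Level; _⊔_) renaming (suc to lsuc)
open import Data.Nat as ℕ using (ℕ; zero; suc; _∸_)
open import Data.Fin using (Fin; toℕ)
open import Data.Bool using (Bool; true; false; if_then_else_; _∧_; not)
open import Data.Product using (Σ; ∃; _×_; _,_)
open import Data.Sum using (_⊎_)
open import Data.List using (List; []; _∷_; map; concatMap; allFin; filterᵇ; foldr)
open import Data.Bool.ListAction using (any)
open import Relation.Binary using (Rel; IsStrictTotalOrder)
open import Relation.Nullary using (¬_)
open import Algebra.Structures using (IsCommutativeRing)

-- An abstract model of the real numbers: a Dedekind-complete ordered
-- field.  (Every such structure is isomorphic to ℝ.)

record RealNumbers (c ℓ : Level) : Set (lsuc (c ⊔ ℓ)) where
  infixl 7 _*_
  infixl 6 _+_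
  infix 4 _≈_ _<_ _≤_
  field
    Carrier  : Set c
    _≈_      : Rel Carrier ℓ
    _+_ _*_  : Carrier → Carrier → Carrier
    -_       : Carrier → Carrier
    0# 1#    : Carrier
    isCommutativeRing : IsCommutativeRing _≈_ _+_ _*_ -_ 0# 1#
    _⁻¹      : Carrier → Carrier
    ⁻¹-inverse : ∀ x → ¬ (x ≈ 0#) → x * (x ⁻¹) ≈ 1#
    _<_      : Rel Carrier ℓ
    isStrictTotalOrder : IsStrictTotalOrder _≈_ _<_
    +-mono-< : ∀ {x y} z → x < y → x + z < y + z
    *-pos    : ∀ {x y} → 0# < x → 0# < y → 0# < x * y
    0<1      : 0# < 1#

  _≤_ : Rel Carrier ℓ
  x ≤ y = (x < y) ⊎ (x ≈ y)

  field
    sup : (S : Carrier → Set ℓ) → (∃ λ x → S x) →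
          (∃ λ u → ∀ x → S x → x ≤ u) →
          ∃ λ s → (∀ x → S x → x ≤ s) × (∀ u → (∀ x → S x → x ≤ u) → s ≤ u)

-- The poset P = [a] × [b] and P̂.  Element (i , j) with i : Fin a, j : Fin b
-- stands for (toℕ i + 1 , toℕ j + 1) ∈ [a] × [b].

P : ℕ → ℕ → Set
P a b = Fin a × Fin b

data P̂ (a b : ℕ) : Set where
  0̂ : P̂ a b
  1̂ : P̂ a b
  el : P a b → P̂ a b

allP : (a b : ℕ) → List (P a b)
allP a b = concatMap (λ i → map (λ j → (i , j)) (allFin b)) (allFin a)

allP̂ : (a b : ℕ) → List (P̂ a b)
allP̂ a b = 0̂ ∷ 1̂ ∷ map el (allP a b)

_<ᵇ_ : ∀ {a b} → P̂ a b → P̂ a b → Bool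
0̂ <ᵇ 0̂ = false
0̂ <ᵇ _ = true
1̂ <ᵇ _ = false
el x <ᵇ 0̂ = false
el x <ᵇ 1̂ = true
el (i , j) <ᵇ el (i' , j') =
  (toℕ i ℕ.≤ᵇ toℕ i') ∧ (toℕ j ℕ.≤ᵇ toℕ j') ∧ not ((toℕ i ℕ.≡ᵇ toℕ i') ∧ (toℕ j ℕ.≡ᵇ toℕ j'))

_⋖ᵇ_ : ∀ {a b} → P̂ a b → P̂ a b → Bool
_⋖ᵇ_ {a} {b} y x = (y <ᵇ x) ∧ not (any (λ z → (y <ᵇ z) ∧ (z <ᵇ x)) (allP̂ a b))

_≡P̂ᵇ_ : ∀ {a b} → P̂ a b → P̂ a b → Bool
0̂ ≡P̂ᵇ 0̂ = true
1̂ ≡P̂ᵇ 1̂ = true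
el (i , j) ≡P̂ᵇ el (i' , j') = (toℕ i ℕ.≡ᵇ toℕ i') ∧ (toℕ j ℕ.≡ᵇ toℕ j')
_ ≡P̂ᵇ _ = false

-- the file of (i', j) (1-indexed) is j - i' + a
file : ∀ {a b} → P a b → ℕ
file {a} (i , j) = (suc (toℕ j) ℕ.+ a) ∸ suc (toℕ i)

module Toggling {c ℓ} (R : RealNumbers c ℓ) where
  open RealNumbers R public

  sumR : List Carrier → Carrier
  sumR = foldr _+_ 0#

  prodR : List Carrier → Carrier
  prodR = foldr _*_ 1#

  parSum : List Carrier → Carrier
  parSum xs = (sumR (map _⁻¹ xs)) ⁻¹

  φ : ∀ {a b} → P a b → (P̂ a b → Carrier) → (P̂ a b → Carrier)
  φ {a} {b} x f y =
    if y ≡P̂ᵇ el x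
    then L * Rr * (f (el x) ⁻¹)
    else f y
    where
      L  = sumR (map f (filterᵇ (λ z → z ⋖ᵇ el x) (allP̂ a b)))
      Rr = parSum (map f (filterᵇ (λ z → el x ⋖ᵇ z) (allP̂ a b)))

  fileElems : (a b i : ℕ) → List (P a b)
  fileElems a b i = filterᵇ (λ x → file x ℕ.≡ᵇ i) (allP a b)

  φ* : ∀ {a b} → ℕ → (P̂ a b → Carrier) → (P̂ a b → Carrier)
  φ* {a} {b} i f = foldr φ f (fileElems a b i)

  p : ∀ {a b} → (P̂ a b → Carrier) → ℕ → Carrier
  p {a} {b} f i =
    if (i ℕ.≡ᵇ 0) Data.Bool.∨ (i ℕ.≡ᵇ (a ℕ.+ b))
    then 1#
    else prodR (map (λ x → f (el x)) (fileElems a b i))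

  Q : ∀ {a b} → (P̂ a b → Carrier) → ℕ → Carrier
  Q f i = p f i * (p f (i ∸ 1) ⁻¹)

σ : ℕ → ℕ → ℕ
σ i k = if k ℕ.≡ᵇ i then suc i else (if k ℕ.≡ᵇ suc i then i else k)

-- Let p_k be the product of f over file k and p′ the same for φ*_s f.
-- Toggles at elements of file s only read values on the adjacent files, so
-- φ*_s acts as independent single toggles on file s and changes only p_s.
-- Everything then follows from the key identity  p′_s · p_s = p_{s-1} · p_{s+1}
-- by cross-multiplication.  For the key identity, at x on file s the new
-- value times the old one is L(x) / S(x), where L(x) sums f over the lower
-- covers and S(x) sums 1/f over the upper covers; as the upper covers of x are the lower covers of the
-- next element x + (1,1) of the file, S(x) · f(x + (1,0)) · f(x + (0,1)) =
-- L(x + (1,1)), and the L's telescope along the file, leaving p_{s-1} p_{s+1}.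

module Submission where

open import Defs
open import Data.Nat as ℕ using (ℕ; zero; suc; z≤n; z<s; s<s; _∸_; _≡ᵇ_; _≤ᵇ_)
  renaming (_+_ to _+ⁿ_; _<_ to _<ⁿ_; _≤_ to _≤ⁿ_; _<ᵇ_ to _<ⁿᵇ_)
import Data.Nat.Properties as ℕₚ
open import Data.Bool using (Bool; true; false; T; _∧_; _∨_; not; if_then_else_)
open import Data.Bool.Properties using (T-∧; ∧-zeroʳ)
open import Data.Unit using (tt)
open import Data.Empty using (⊥; ⊥-elim)
open import Data.Product using (Σ; _×_; _,_; proj₁; proj₂)
open import Data.Sum using (_⊎_; inj₁; inj₂)
open import Data.List using (List; []; _∷_; _++_; map; filterᵇ; foldr; concatMap; allFin; tabulate)
open import Data.Fin using (Fin; toℕ) renaming (zero to fzero; suc to fsuc)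
open import Relation.Nullary using (¬_; Dec; _because_; yes; no)
open import Relation.Binary.Definitions using (tri<; tri≈; tri>)
open import Relation.Nullary.Reflects using (Reflects; ofʸ; ofⁿ; det; T-reflects; ¬-reflects; _×-reflects_; _⊎-reflects_; fromEquivalence)
open import Relation.Binary.PropositionalEquality as ≡ using (_≡_; _≢_; refl; cong; cong₂)
open import Algebra.Bundles using (CommutativeMonoid)
open import Function.Bundles using (_⇔_; mk⇔; Equivalence)

module _ {A : Set} where

  reflects-sound : ∀ {c} → Reflects A c → T c → A
  reflects-sound (ofʸ x) _ = x

  reflects-complete : ∀ {c} → Reflects A c → A → T c
  reflects-complete (ofʸ _)  _ = tt
  reflects-complete (ofⁿ ¬x) x = ¬x x

  reflects-map : ∀ {B : Set} {c} → (A → B) → (B → A) → Reflects A c → Reflects B c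
  reflects-map to from (ofʸ x)  = ofʸ (to x)
  reflects-map to from (ofⁿ ¬x) = ofⁿ (λ y → ¬x (from y))

  decide : ∀ {c} → Reflects A c → Dec A
  decide {c} r = c because r

  if-yes : ∀ {c} {ℓ} {B : Set ℓ} {x y : B} → Reflects A c → A → (if c then x else y) ≡ x
  if-yes (ofʸ _)  _ = refl
  if-yes (ofⁿ ¬x) x = ⊥-elim (¬x x)

  if-no : ∀ {c} {ℓ} {B : Set ℓ} {x y : B} → Reflects A c → ¬ A → (if c then x else y) ≡ y
  if-no (ofʸ x) ¬x = ⊥-elim (¬x x)
  if-no (ofⁿ _) _  = refl

≡ᵇ-reflects : ∀ m n → Reflects (m ≡ n) (m ≡ᵇ n)
≡ᵇ-reflects m n = fromEquivalence (ℕₚ.≡ᵇ⇒≡ m n) (ℕₚ.≡⇒≡ᵇ m n)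

≡ᵇ-sym : ∀ m n → (m ≡ᵇ n) ≡ (n ≡ᵇ m)
≡ᵇ-sym m n = det (≡ᵇ-reflects m n) (reflects-map ≡.sym ≡.sym (≡ᵇ-reflects n m))

module BigOp {c ℓ} (M : CommutativeMonoid c ℓ) where
  open CommutativeMonoid M renaming (Carrier to C; refl to ≈-refl; sym to ≈-sym; trans to ≈-trans; reflexive to ≈-reflexive)
  open import Relation.Binary.Reasoning.Setoid setoid

  fold : List C → C
  fold = foldr _∙_ ε

  big : ℕ → (ℕ → C) → C
  big zero    H = ε
  big (suc n) H = H 0 ∙ big n (λ k → H (suc k))

  fold-++ : ∀ xs ys → fold (xs ++ ys) ≈ fold xs ∙ fold ys
  fold-++ []       ys = ≈-sym (identityˡ _)
  fold-++ (x ∷ xs) ys = ≈-trans (∙-congˡ (fold-++ xs ys)) (≈-sym (assoc _ _ _))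

  fold-filter : ∀ {A : Set} (q : A → Bool) (h : A → C) xs →
    fold (map h (filterᵇ q xs)) ≈ fold (map (λ x → if q x then h x else ε) xs)
  fold-filter q h []       = ≈-refl
  fold-filter q h (x ∷ xs) with q x
  ... | true  = ∙-congˡ (fold-filter q h xs)
  ... | false = ≈-trans (fold-filter q h xs) (≈-sym (identityˡ _))

  fold-concatMap : ∀ {A B : Set} (R : A → List B) (h : B → C) xs →
    fold (map h (concatMap R xs)) ≈ fold (map (λ x → fold (map h (R x))) xs)
  fold-concatMap R h []       = ≈-refl
  fold-concatMap R h (x ∷ xs) = begin
    fold (map h (R x ++ concatMap R xs))
      ≡⟨ cong fold (Data.List.Properties.map-++ h (R x) (concatMap R xs)) ⟩
    fold (map h (R x) ++ map h (concatMap R xs))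
      ≈⟨ fold-++ (map h (R x)) _ ⟩
    fold (map h (R x)) ∙ fold (map h (concatMap R xs))
      ≈⟨ ∙-congˡ (fold-concatMap R h xs) ⟩
    fold (map h (R x)) ∙ fold (map (λ x → fold (map h (R x))) xs) ∎
    where import Data.List.Properties

  fold-tabulate : ∀ {A : Set} n (g : Fin n → A) (h : A → C) (H : ℕ → C) →
    (∀ k → h (g k) ≈ H (toℕ k)) → fold (map h (tabulate g)) ≈ big n H
  fold-tabulate zero    g h H e = ≈-refl
  fold-tabulate (suc n) g h H e =
    ∙-cong (e fzero) (fold-tabulate n (λ k → g (fsuc k)) h (λ k → H (suc k)) (λ k → e (fsuc k)))

  big-cong : ∀ n {H H′} → (∀ k → k <ⁿ n → H k ≈ H′ k) → big n H ≈ big n H′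
  big-cong zero    e = ≈-refl
  big-cong (suc n) e = ∙-cong (e 0 z<s) (big-cong n (λ k k<n → e (suc k) (s<s k<n)))

  big-ε : ∀ n {H} → (∀ k → k <ⁿ n → H k ≈ ε) → big n H ≈ ε
  big-ε zero    e = ≈-refl
  big-ε (suc n) e = ≈-trans (∙-cong (e 0 z<s) (big-ε n (λ k k<n → e (suc k) (s<s k<n)))) (identityˡ ε)

  big-∙ : ∀ n H H′ → big n (λ k → H k ∙ H′ k) ≈ big n H ∙ big n H′
  big-∙ zero    H H′ = ≈-sym (identityˡ ε)
  big-∙ (suc n) H H′ = begin
    (H 0 ∙ H′ 0) ∙ big n (λ k → H (suc k) ∙ H′ (suc k)) ≈⟨ ∙-congˡ (big-∙ n _ _) ⟩
    (H 0 ∙ H′ 0) ∙ (X ∙ Y)                               ≈⟨ assoc _ _ _ ⟩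
    H 0 ∙ (H′ 0 ∙ (X ∙ Y))                               ≈⟨ ∙-congˡ (x∙yz≈y∙xz _ _ _) ⟩
    H 0 ∙ (X ∙ (H′ 0 ∙ Y))                               ≈⟨ ≈-sym (assoc _ _ _) ⟩
    (H 0 ∙ X) ∙ (H′ 0 ∙ Y)                               ∎
    where
    open import Algebra.Properties.CommutativeSemigroup commutativeSemigroup using (x∙yz≈y∙xz)
    X Y : C
    X = big n (λ k → H (suc k))
    Y = big n (λ k → H′ (suc k))

  big-last : ∀ n H → big (suc n) H ≈ big n H ∙ H n
  big-last zero    H = ≈-trans (identityʳ _) (≈-sym (identityˡ _))
  big-last (suc n) H = ≈-trans (∙-congˡ (big-last n (λ k → H (suc k)))) (≈-sym (assoc _ _ _))

  big-point : ∀ n (H : ℕ → C) m →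
    big n (λ k → if k ≡ᵇ m then H k else ε) ≈ (if m <ⁿᵇ n then H m else ε)
  big-point zero    H m       = ≈-refl
  big-point (suc n) H zero    = ≈-trans (∙-congˡ (big-ε n (λ _ _ → ≈-refl))) (identityʳ _)
  big-point (suc n) H (suc m) = ≈-trans (identityˡ _) (big-point n (λ k → H (suc k)) m)

  telescope : ∀ n (A B N : ℕ → C) → (∀ t → t <ⁿ n → A t ∙ N (suc t) ≈ N t ∙ B t) →
    big n A ∙ N n ≈ N 0 ∙ big n B
  telescope zero    A B N step = ≈-trans (identityˡ _) (≈-sym (identityʳ _))
  telescope (suc n) A B N step = begin
    (A 0 ∙ big n A′) ∙ N (suc n)  ≈⟨ assoc _ _ _ ⟩
    A 0 ∙ (big n A′ ∙ N (suc n))  ≈⟨ ∙-congˡ (telescope n A′ B′ (λ t → N (suc t)) (λ t t<n → step (suc t) (s<s t<n))) ⟩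
    A 0 ∙ (N 1 ∙ big n B′)        ≈⟨ ≈-sym (assoc _ _ _) ⟩
    (A 0 ∙ N 1) ∙ big n B′        ≈⟨ ∙-congʳ (step 0 z<s) ⟩
    (N 0 ∙ B 0) ∙ big n B′        ≈⟨ assoc _ _ _ ⟩
    N 0 ∙ (B 0 ∙ big n B′)        ∎
    where
    A′ B′ : ℕ → C
    A′ k = A (suc k)
    B′ k = B (suc k)

  big² : ℕ → ℕ → (ℕ → ℕ → C) → C
  big² m n H = big m (λ t → big n (H t))

  big²-cong : ∀ m n {H H′} → (∀ t j → t <ⁿ m → j <ⁿ n → H t j ≈ H′ t j) → big² m n H ≈ big² m n H′
  big²-cong m n e = big-cong m (λ t t<m → big-cong n (λ j j<n → e t j t<m j<n))

  big²-ε : ∀ m n {H} → (∀ t j → H t j ≈ ε) → big² m n H ≈ ε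
  big²-ε m n e = big-ε m (λ t _ → big-ε n (λ j _ → e t j))

  big²-∙ : ∀ m n H H′ → big² m n (λ t j → H t j ∙ H′ t j) ≈ big² m n H ∙ big² m n H′
  big²-∙ m n H H′ = ≈-trans (big-cong m (λ t _ → big-∙ n (H t) (H′ t))) (big-∙ m _ _)

  grid-point : ∀ m n (H : ℕ → ℕ → C) u v →
    big² m n (λ t j → if (t ≡ᵇ u) ∧ (j ≡ᵇ v) then H t j else ε) ≈
    (if u <ⁿᵇ m then (if v <ⁿᵇ n then H u v else ε) else ε)
  grid-point m n H u v = ≈-trans (big-cong m (λ t _ → row-point t)) (big-point m (λ t → if v <ⁿᵇ n then H t v else ε) u)
    where
    row-point : ∀ t → big n (λ j → if (t ≡ᵇ u) ∧ (j ≡ᵇ v) then H t j else ε) ≈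
                      (if t ≡ᵇ u then (if v <ⁿᵇ n then H t v else ε) else ε)
    row-point t with t ≡ᵇ u
    ... | true  = big-point n (H t) v
    ... | false = big-ε n (λ _ _ → ≈-refl)

  if-∨ : ∀ x y (v : C) → ¬ (T x × T y) → (if x ∨ y then v else ε) ≈ (if x then v else ε) ∙ (if y then v else ε)
  if-∨ true  true  v both = ⊥-elim (both (tt , tt))
  if-∨ true  false v _    = ≈-sym (identityʳ v)
  if-∨ false true  v _    = ≈-sym (identityˡ v)
  if-∨ false false v _    = ≈-sym (identityˡ ε)

  fold-allP : ∀ {a b} (h : P a b → C) (H : ℕ → ℕ → C) →
    (∀ t j → h (t , j) ≈ H (toℕ t) (toℕ j)) → fold (map h (allP a b)) ≈ big² a b H
  fold-allP {a} {b} h H e =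
    ≈-trans (fold-concatMap (λ t → map (λ j → (t , j)) (allFin b)) h (allFin a))
            (fold-tabulate a (λ t → t) _ _ λ t →
              ≈-trans (≈-reflexive (cong fold (≡.sym (Data.List.Properties.map-∘ (allFin b)))))
                      (fold-tabulate b (λ j → j) _ _ (e t)))
    where import Data.List.Properties

Below : ℕ → ℕ → ℕ → ℕ → Set
Below t′ j′ t j = t′ ≤ⁿ t × j′ ≤ⁿ j × ¬ (t′ ≡ t × j′ ≡ j)

below-reflects : ∀ t′ j′ t j →
  Reflects (Below t′ j′ t j) ((t′ ≤ᵇ t) ∧ (j′ ≤ᵇ j) ∧ not ((t′ ≡ᵇ t) ∧ (j′ ≡ᵇ j)))
below-reflects t′ j′ t j =
  ℕₚ.≤ᵇ-reflects-≤ t′ t ×-reflects ℕₚ.≤ᵇ-reflects-≤ j′ j ×-reflects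
  ¬-reflects (≡ᵇ-reflects t′ t ×-reflects ≡ᵇ-reflects j′ j)

Step : ℕ → ℕ → ℕ → ℕ → Set
Step t′ j′ t j = (suc t′ ≡ t × j′ ≡ j) ⊎ (t′ ≡ t × suc j′ ≡ j)

stepᵇ : ℕ → ℕ → ℕ → ℕ → Bool
stepᵇ t′ j′ t j = ((suc t′ ≡ᵇ t) ∧ (j′ ≡ᵇ j)) ∨ ((t′ ≡ᵇ t) ∧ (suc j′ ≡ᵇ j))

step-reflects : ∀ t′ j′ t j → Reflects (Step t′ j′ t j) (stepᵇ t′ j′ t j)
step-reflects t′ j′ t j =
  (≡ᵇ-reflects (suc t′) t ×-reflects ≡ᵇ-reflects j′ j) ⊎-reflects
  (≡ᵇ-reflects t′ t ×-reflects ≡ᵇ-reflects (suc j′) j)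

step⇒below : ∀ {t′ j′ t j} → Step t′ j′ t j → Below t′ j′ t j
step⇒below (inj₁ (refl , refl)) = ℕₚ.n≤1+n _ , ℕₚ.≤-refl , λ (e , _) → ℕₚ.1+n≢n (≡.sym e)
step⇒below (inj₂ (refl , refl)) = ℕₚ.≤-refl , ℕₚ.n≤1+n _ , λ (_ , e) → ℕₚ.1+n≢n (≡.sym e)

squeeze : ∀ {m n} → m ≤ⁿ n → n ≤ⁿ suc m → m ≡ n ⊎ n ≡ suc m
squeeze m≤n n≤1+m with ℕₚ.m≤n⇒m<n∨m≡n n≤1+m
... | inj₁ n<1+m = inj₁ (ℕₚ.≤-antisym m≤n (ℕₚ.≤-pred n<1+m))
... | inj₂ n≡1+m = inj₂ n≡1+m

step-no-middle : ∀ {t′ j′ t j u v} → Step t′ j′ t j → Below t′ j′ u v → Below u v t j → ⊥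
step-no-middle (inj₁ (refl , refl)) (t′≤u , j′≤v , ne₁) (u≤t , v≤j , ne₂)
  with ℕₚ.≤-antisym v≤j j′≤v | squeeze t′≤u u≤t
... | v≡j′ | inj₁ t′≡u  = ne₁ (t′≡u , ≡.sym v≡j′)
... | v≡j′ | inj₂ u≡1+t′ = ne₂ (u≡1+t′ , v≡j′)
step-no-middle (inj₂ (refl , refl)) (t′≤u , j′≤v , ne₁) (u≤t , v≤j , ne₂)
  with ℕₚ.≤-antisym u≤t t′≤u | squeeze j′≤v v≤j
... | u≡t′ | inj₁ j′≡v  = ne₁ (≡.sym u≡t′ , j′≡v)
... | u≡t′ | inj₂ v≡1+j′ = ne₂ (u≡t′ , v≡1+j′)

middle : ∀ {t′ j′ t j} → Below t′ j′ t j → ¬ Step t′ j′ t j →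
  (Below t′ j′ (suc t′) j′ × Below (suc t′) j′ t j) ⊎ (Below t′ j′ t′ (suc j′) × Below t′ (suc j′) t j)
middle (t′≤t , j′≤j , ne) ¬step with ℕₚ.m≤n⇒m<n∨m≡n t′≤t
... | inj₁ t′<t = inj₁ ( step⇒below (inj₁ (refl , refl))
                       , t′<t , j′≤j , λ (e₁ , e₂) → ¬step (inj₁ (e₁ , e₂)))
... | inj₂ refl with ℕₚ.m≤n⇒m<n∨m≡n j′≤j
...   | inj₁ j′<j = inj₂ ( step⇒below (inj₂ (refl , refl))
                         , ℕₚ.≤-refl , j′<j , λ (e₁ , e₂) → ¬step (inj₂ (e₁ , e₂)))
...   | inj₂ refl = ⊥-elim (ne (refl , refl))

module Order {a b : ℕ} where
  open import Data.Fin using (fromℕ<)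
  open import Data.Fin.Properties using (toℕ<n; toℕ-fromℕ<)
  open import Data.List using (cartesianProduct)
  open import Data.List.Membership.Propositional using (_∈_; lose)
  open import Data.List.Membership.Propositional.Properties using (∈-map⁺; ∈-allFin; ∈-cartesianProduct⁺)
  open import Data.List.Relation.Unary.Any using (Any; here; there; satisfied)
  open import Data.List.Relation.Unary.Any.Properties using (any⁺; any⁻)
  open import Data.List.Relation.Unary.Unique.Propositional using (Unique)
  import Data.List.Relation.Unary.Unique.Propositional.Properties as Uniqueₚ

  row col : P a b → ℕ
  row (t , _) = toℕ t
  col (_ , j) = toℕ j

  allP≡cartesianProduct : allP a b ≡ cartesianProduct (allFin a) (allFin b)
  allP≡cartesianProduct = go (allFin a)
    where
    go : ∀ ts → concatMap (λ t → map (λ j → (t , j)) (allFin b)) ts ≡ cartesianProduct ts (allFin b)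
    go []       = refl
    go (t ∷ ts) = cong (map (λ j → (t , j)) (allFin b) ++_) (go ts)

  ∈-allP : ∀ x → x ∈ allP a b
  ∈-allP (t , j) rewrite allP≡cartesianProduct = ∈-cartesianProduct⁺ (∈-allFin t) (∈-allFin j)

  allP-unique : Unique (allP a b)
  allP-unique rewrite allP≡cartesianProduct = Uniqueₚ.cartesianProduct⁺ (Uniqueₚ.allFin⁺ a) (Uniqueₚ.allFin⁺ b)

  ∈-allP̂ : ∀ z → z ∈ allP̂ a b
  ∈-allP̂ 0̂      = here refl
  ∈-allP̂ 1̂      = there (here refl)
  ∈-allP̂ (el x) = there (there (∈-map⁺ el (∈-allP x)))

  Cover : P̂ a b → P̂ a b → Set
  Cover y x = T (y <ᵇ x) × ¬ Any (λ z → T ((y <ᵇ z) ∧ (z <ᵇ x))) (allP̂ a b)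

  cover-reflects : ∀ y x → Reflects (Cover y x) (y ⋖ᵇ x)
  cover-reflects y x = T-reflects (y <ᵇ x) ×-reflects ¬-reflects (fromEquivalence (any⁻ _ _) (any⁺ _))

  no-between : ∀ {y x} z → T (y <ᵇ z) → T (z <ᵇ x) → ¬ Cover y x
  no-between z y<z z<x (_ , none) = none (lose (∈-allP̂ z) (Equivalence.from T-∧ (y<z , z<x)))

  below-el : ∀ (y x : P a b) → Reflects (Below (row y) (col y) (row x) (col x)) (el y <ᵇ el x)
  below-el (t′ , j′) (t , j) = below-reflects (toℕ t′) (toℕ j′) (toℕ t) (toℕ j)

  no-middle : ∀ {y x} u v (u<a : u <ⁿ a) (v<b : v <ⁿ b) →
    (∀ {w} → row w ≡ u → col w ≡ v → T (y <ᵇ el w) × T (el w <ᵇ x)) → ¬ Cover y x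
  no-middle {y} {x} u v u<a v<b between = no-between {y} {x} (el w) (proj₁ w-between) (proj₂ w-between)
    where
    w : P a b
    w = (fromℕ< u<a , fromℕ< v<b)
    w-between : T (y <ᵇ el w) × T (el w <ᵇ x)
    w-between = between (toℕ-fromℕ< u<a) (toℕ-fromℕ< v<b)

  cover-el : ∀ (y x : P a b) → (el y ⋖ᵇ el x) ≡ stepᵇ (row y) (col y) (row x) (col x)
  cover-el y x = det (reflects-map cover⇒step step⇒cover (cover-reflects (el y) (el x)))
                     (step-reflects (row y) (col y) (row x) (col x))
    where
    Y X : P̂ a b
    Y = el y
    X = el x
    lift : ∀ {u v w} → row w ≡ u → col w ≡ v → Below (row y) (col y) u v → Below u v (row x) (col x) →
      T (Y <ᵇ el w) × T (el w <ᵇ X)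
    lift {w = w} refl refl y<w w<x = reflects-complete (below-el y w) y<w , reflects-complete (below-el w x) w<x
    cover⇒step : Cover Y X → Step (row y) (col y) (row x) (col x)
    cover⇒step cov@(y<x , _) with decide (step-reflects (row y) (col y) (row x) (col x))
    ... | yes step = step
    ... | no ¬step with middle (reflects-sound (below-el y x) y<x) ¬step
    ...   | inj₁ (y<w , w<x) = ⊥-elim (no-middle _ _ (ℕₚ.≤-<-trans (proj₁ w<x) (toℕ<n (proj₁ x))) (toℕ<n (proj₂ y))
                                                 (λ eu ev → lift eu ev y<w w<x) cov)
    ...   | inj₂ (y<w , w<x) = ⊥-elim (no-middle _ _ (toℕ<n (proj₁ y)) (ℕₚ.≤-<-trans (proj₁ (proj₂ w<x)) (toℕ<n (proj₂ x)))
                                                 (λ eu ev → lift eu ev y<w w<x) cov)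
    step⇒cover : Step (row y) (col y) (row x) (col x) → Cover Y X
    step⇒cover step = reflects-complete (below-el y x) (step⇒below step) , λ any → strictly-between (satisfied any)
      where
      strictly-between : ¬ Σ (P̂ a b) (λ z → T ((Y <ᵇ z) ∧ (z <ᵇ X)))
      strictly-between (el w , y<w<x) with Equivalence.to T-∧ y<w<x
      ... | y<w , w<x = step-no-middle step (reflects-sound (below-el y w) y<w) (reflects-sound (below-el w x) w<x)

  cover-0̂ : ∀ (x : P a b) → (0̂ ⋖ᵇ el x) ≡ ((row x ≡ᵇ 0) ∧ (col x ≡ᵇ 0))
  cover-0̂ x = det (reflects-map cover⇒origin origin⇒cover (cover-reflects 0̂ (el x)))
                  (≡ᵇ-reflects (row x) 0 ×-reflects ≡ᵇ-reflects (col x) 0)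
    where
    cover⇒origin : Cover 0̂ (el x) → row x ≡ 0 × col x ≡ 0
    cover⇒origin cov with decide (≡ᵇ-reflects (row x) 0 ×-reflects ≡ᵇ-reflects (col x) 0)
    ... | yes origin = origin
    ... | no ¬origin = ⊥-elim (no-middle {0̂} {el x} 0 0 (ℕₚ.≤-<-trans z≤n (toℕ<n (proj₁ x))) (ℕₚ.≤-<-trans z≤n (toℕ<n (proj₂ x)))
                                 (λ {w} w₀ w₁ → tt , reflects-complete (below-el w x) (origin-below w₀ w₁)) cov)
      where
      origin-below : ∀ {u v} → u ≡ 0 → v ≡ 0 → Below u v (row x) (col x)
      origin-below refl refl = z≤n , z≤n , λ (e₁ , e₂) → ¬origin (≡.sym e₁ , ≡.sym e₂)
    origin⇒cover : row x ≡ 0 × col x ≡ 0 → Cover 0̂ (el x)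
    origin⇒cover (t≡0 , j≡0) = tt , λ any → nothing-below (satisfied any)
      where
      nothing-below : ¬ Σ (P̂ a b) (λ z → T ((0̂ <ᵇ z) ∧ (z <ᵇ el x)))
      nothing-below (el w , w<x) with reflects-sound (below-el w x) w<x
      ... | t′≤t , j′≤j , ne = ne ( ≡.trans (ℕₚ.n≤0⇒n≡0 (≡.subst (row w ≤ⁿ_) t≡0 t′≤t)) (≡.sym t≡0)
                                  , ≡.trans (ℕₚ.n≤0⇒n≡0 (≡.subst (col w ≤ⁿ_) j≡0 j′≤j)) (≡.sym j≡0) )

  cover-1̂ : ∀ (x : P a b) → (el x ⋖ᵇ 1̂) ≡ ((suc (row x) ≡ᵇ a) ∧ (suc (col x) ≡ᵇ b))
  cover-1̂ x = det (reflects-map cover⇒top top⇒cover (cover-reflects (el x) 1̂))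
                  (≡ᵇ-reflects (suc (row x)) a ×-reflects ≡ᵇ-reflects (suc (col x)) b)
    where
    pred< : ∀ {m n} → m <ⁿ n → ℕ.pred n <ⁿ n
    pred< {n = suc n} _ = ℕₚ.n<1+n n
    suc-pred : ∀ {m n} → m <ⁿ n → suc (ℕ.pred n) ≡ n
    suc-pred {n = suc n} _ = refl
    t<a : row x <ⁿ a
    t<a = toℕ<n (proj₁ x)
    j<b : col x <ⁿ b
    j<b = toℕ<n (proj₂ x)
    cover⇒top : Cover (el x) 1̂ → suc (row x) ≡ a × suc (col x) ≡ b
    cover⇒top cov with decide (≡ᵇ-reflects (suc (row x)) a ×-reflects ≡ᵇ-reflects (suc (col x)) b)
    ... | yes top = top
    ... | no ¬top = ⊥-elim (no-middle {el x} {1̂} (ℕ.pred a) (ℕ.pred b) (pred< t<a) (pred< j<b)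
                              (λ {w} w₀ w₁ → reflects-complete (below-el x w) (below-top w₀ w₁) , tt) cov)
      where
      below-top : ∀ {u v} → u ≡ ℕ.pred a → v ≡ ℕ.pred b → Below (row x) (col x) u v
      below-top refl refl = ℕₚ.pred-mono-≤ t<a , ℕₚ.pred-mono-≤ j<b ,
        λ (e₁ , e₂) → ¬top (≡.trans (cong suc e₁) (suc-pred t<a) , ≡.trans (cong suc e₂) (suc-pred j<b))
    top⇒cover : suc (row x) ≡ a × suc (col x) ≡ b → Cover (el x) 1̂
    top⇒cover (t≡a , j≡b) = tt , λ any → nothing-above (satisfied any)
      where
      nothing-above : ¬ Σ (P̂ a b) (λ z → T ((el x <ᵇ z) ∧ (z <ᵇ 1̂)))
      nothing-above (el w , x<w) with reflects-sound (below-el x w) (proj₁ (Equivalence.to T-∧ x<w))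
      ... | t≤t′ , j≤j′ , ne =
        ne ( ℕₚ.≤-antisym t≤t′ (ℕₚ.≤-pred (≡.subst (suc (row w) ≤ⁿ_) (≡.sym t≡a) (toℕ<n (proj₁ w))))
           , ℕₚ.≤-antisym j≤j′ (ℕₚ.≤-pred (≡.subst (suc (col w) ≤ⁿ_) (≡.sym j≡b) (toℕ<n (proj₂ w)))) )

-- Covering elements lie in adjacent files, so
-- the toggles of one file do not interact: φ* s replaces the value at
-- each x of file s by the single toggle of the original function at x,
-- and changes nothing else.

module FileToggle {c ℓ} (R : RealNumbers c ℓ) {a b : ℕ} where
  open Toggling R
  open Order {a} {b}
  open import Data.Fin.Properties using (toℕ<n; toℕ-injective)
  open import Data.List.Membership.Propositional using (_∈_)
  open import Data.List.Membership.Propositional.Properties using (∈-filter⁺)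
  open import Data.List.Properties using (map-cong-local)
  open import Data.List.Relation.Unary.All as All using (All; []; _∷_)
  open import Data.List.Relation.Unary.All.Properties using (all-filter)
  open import Data.List.Relation.Unary.Any using (here; there)
  open import Data.List.Relation.Unary.AllPairs using (_∷_)
  open import Data.List.Relation.Unary.Unique.Propositional using (Unique)
  import Data.List.Relation.Unary.Unique.Propositional.Properties as Uniqueₚ
  open import Relation.Nullary.Decidable using (T?)

  lowerSum upperPar : (P̂ a b → Carrier) → P a b → Carrier
  lowerSum g x = sumR (map g (filterᵇ (λ z → z ⋖ᵇ el x) (allP̂ a b)))
  upperPar g x = parSum (map g (filterᵇ (λ z → el x ⋖ᵇ z) (allP̂ a b)))

  toggled : (P̂ a b → Carrier) → P a b → Carrier
  toggled g x = lowerSum g x * upperPar g x * (g (el x) ⁻¹)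

  el-injective : ∀ {x y : P a b} → el x ≡ el y → x ≡ y
  el-injective refl = refl

  ≡P̂-reflects : ∀ (y x : P a b) → Reflects (y ≡ x) (el y ≡P̂ᵇ el x)
  ≡P̂-reflects (t′ , j′) (t , j) =
    reflects-map (λ (e₁ , e₂) → cong₂ _,_ (toℕ-injective e₁) (toℕ-injective e₂)) (λ { refl → refl , refl })
                 (≡ᵇ-reflects (toℕ t′) (toℕ t) ×-reflects ≡ᵇ-reflects (toℕ j′) (toℕ j))

  φ-at : ∀ x g → φ x g (el x) ≡ toggled g x
  φ-at x g = if-yes (≡P̂-reflects x x) refl

  φ-outside : ∀ x z g → z ≢ el x → φ x g z ≡ g z
  φ-outside x 0̂      g _   = refl
  φ-outside x 1̂      g _   = refl
  φ-outside x (el y) g y≢x = if-no (≡P̂-reflects y x) (λ y≡x → y≢x (cong el y≡x))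

  file+row : ∀ (x : P a b) → file x +ⁿ row x ≡ col x +ⁿ a
  file+row (t , j) = ℕₚ.m∸n+n≡m (ℕₚ.≤-trans (ℕₚ.<⇒≤ (toℕ<n t)) (ℕₚ.m≤n+m a (toℕ j)))

  step-file : ∀ y x → Step (row y) (col y) (row x) (col x) → file y ≢ file x
  step-file y x (inj₁ (row≡ , col≡)) same = ℕₚ.1+n≢n (ℕₚ.+-cancelˡ-≡ (file x) _ _ (begin
    file x +ⁿ suc (row y)  ≡⟨ cong (file x +ⁿ_) row≡ ⟩
    file x +ⁿ row x        ≡⟨ file+row x ⟩
    col x +ⁿ a             ≡⟨ cong (_+ⁿ a) (≡.sym col≡) ⟩
    col y +ⁿ a             ≡⟨ ≡.sym (file+row y) ⟩
    file y +ⁿ row y        ≡⟨ cong (_+ⁿ row y) same ⟩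
    file x +ⁿ row y        ∎))
    where open ≡.≡-Reasoning
  step-file y x (inj₂ (row≡ , col≡)) same = ℕₚ.1+n≢n (≡.sym (begin
    file x +ⁿ row x        ≡⟨ file+row x ⟩
    col x +ⁿ a             ≡⟨ cong (_+ⁿ a) (≡.sym col≡) ⟩
    suc (col y +ⁿ a)       ≡⟨ cong suc (≡.sym (file+row y)) ⟩
    suc (file y +ⁿ row y)  ≡⟨ cong₂ (λ f r → suc (f +ⁿ r)) same row≡ ⟩
    suc (file x +ⁿ row x)  ∎))
    where open ≡.≡-Reasoning

  cover-file : ∀ y x → T (el y ⋖ᵇ el x) → file y ≢ file x
  cover-file y x y⋖x = step-file y x (reflects-sound (step-reflects _ _ _ _) (≡.subst T (cover-el y x) y⋖x))

  toggled-cong : ∀ {g g′} x → (∀ z → T (z ⋖ᵇ el x) → g z ≡ g′ z) → (∀ z → T (el x ⋖ᵇ z) → g z ≡ g′ z) →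
    g (el x) ≡ g′ (el x) → toggled g x ≡ toggled g′ x
  toggled-cong x lower upper at =
    cong₂ _*_ (cong₂ _*_ (cong sumR (agree lower)) (cong parSum (agree upper))) (cong _⁻¹ at)
    where
    agree : ∀ {g g′} {q : P̂ a b → Bool} → (∀ z → T (q z) → g z ≡ g′ z) →
      map g (filterᵇ q (allP̂ a b)) ≡ map g′ (filterᵇ q (allP̂ a b))
    agree {q = q} h = map-cong-local (All.map (λ {z} → h z) (all-filter (λ z → T? (q z)) (allP̂ a b)))

  module _ (g : P̂ a b → Carrier) where

    fold-outside : ∀ xs z → All (λ x → z ≢ el x) xs → foldr φ g xs z ≡ g z
    fold-outside []       z []            = refl
    fold-outside (x ∷ xs) z (z≢x ∷ z∉xs) = ≡.trans (φ-outside x z _ z≢x) (fold-outside xs z z∉xs)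

    fold-at : ∀ s xs → Unique xs → All (λ x → file x ≡ s) xs → ∀ y → y ∈ xs → foldr φ g xs (el y) ≡ toggled g y
    fold-at s (x ∷ xs) (x∉xs ∷ _) (fx ∷ fxs) .x (here refl) =
      ≡.trans (φ-at x (foldr φ g xs)) (toggled-cong x (neighbour λ w c → cover-file w x c)
                                                      (neighbour λ w c e → cover-file x w c (≡.sym e))
                                                      (fold-outside xs (el x) (All.map (λ x≢w e → x≢w (el-injective e)) x∉xs)))
      where
      -- a point adjacent to x is not in file s, hence untouched by the toggles of xs
      neighbour : ∀ {Near : P̂ a b → Set} → (∀ w → Near (el w) → file w ≢ file x) → ∀ z → Near z → foldr φ g xs z ≡ g z
      neighbour {Near} apart z near = fold-outside xs z (All.map (λ {w} fw z≡w → apart w (≡.subst Near z≡w near) (≡.trans fw (≡.sym fx))) fxs)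
    fold-at s (x ∷ xs) (x∉xs ∷ u) (_ ∷ fxs) y (there y∈xs) =
      ≡.trans (φ-outside x (el y) _ (λ e → All.lookup x∉xs y∈xs (≡.sym (el-injective e)))) (fold-at s xs u fxs y y∈xs)

  fileElems-file : ∀ s → All (λ x → file x ≡ s) (fileElems a b s)
  fileElems-file s = All.map (ℕₚ.≡ᵇ⇒≡ _ s) (all-filter (λ x → T? (file x ≡ᵇ s)) (allP a b))

  φ*-on : ∀ s g x → file x ≡ s → φ* s g (el x) ≡ toggled g x
  φ*-on s g x fx = fold-at g s (fileElems a b s) (Uniqueₚ.filter⁺ _ allP-unique) (fileElems-file s) x
                     (∈-filter⁺ (λ x → T? (file x ≡ᵇ s)) (∈-allP x) (ℕₚ.≡⇒≡ᵇ _ _ fx))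

  φ*-off : ∀ s g x → file x ≢ s → φ* s g (el x) ≡ g (el x)
  φ*-off s g x fx≢s = fold-outside g (fileElems a b s) (el x)
                        (All.map (λ fw e → fx≢s (≡.trans (cong file (el-injective e)) fw)) (fileElems-file s))

  p-cong : ∀ {g g′} k → (∀ x → file x ≡ k → g (el x) ≡ g′ (el x)) → p g k ≡ p g′ k
  p-cong k agree = cong (λ vs → if (k ≡ᵇ 0) ∨ (k ≡ᵇ (a +ⁿ b)) then 1# else prodR vs)
    (map-cong-local (All.map (λ {x} fx → agree x fx) (fileElems-file k)))

module Positive {c ℓ} (R : RealNumbers c ℓ) where
  open Toggling R public
  open import Algebra.Bundles using (CommutativeRing)
  open import Relation.Binary.Structures using (IsStrictTotalOrder)

  ring : CommutativeRing c ℓ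
  ring = record { isCommutativeRing = isCommutativeRing }

  open CommutativeRing ring public
    using (setoid; +-commutativeMonoid; *-commutativeMonoid; +-cong; *-cong; *-assoc; *-comm;
           +-identityˡ; +-identityʳ; *-identityˡ; *-identityʳ; distribʳ; zeroʳ; -‿inverseˡ; -‿inverseʳ)
    renaming (refl to ≈-refl; sym to ≈-sym; trans to ≈-trans; reflexive to ≈-reflexive)
  open IsStrictTotalOrder isStrictTotalOrder using (compare; irrefl; <-respʳ-≈; <-respˡ-≈)
    renaming (trans to <-trans)
  open import Relation.Binary.Reasoning.Setoid setoid public
  open import Algebra.Solver.CommutativeMonoid *-commutativeMonoid public
    using (solve) renaming (_⊕_ to _⊛_; _⊜_ to _≐_)

  pos⇒≉0 : ∀ {x} → 0# < x → ¬ (x ≈ 0#)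
  pos⇒≉0 0<x x≈0 = irrefl ≈-refl (<-respʳ-≈ x≈0 0<x)

  inverseʳ : ∀ {x} → 0# < x → x * x ⁻¹ ≈ 1#
  inverseʳ 0<x = ⁻¹-inverse _ (pos⇒≉0 0<x)

  inverseˡ : ∀ {x} → 0# < x → x ⁻¹ * x ≈ 1#
  inverseˡ 0<x = ≈-trans (*-comm _ _) (inverseʳ 0<x)

  pos-resp : ∀ {x y} → x ≈ y → 0# < x → 0# < y
  pos-resp = <-respʳ-≈

  pos-+ : ∀ {x y} → 0# < x → 0# < y → 0# < x + y
  pos-+ {x} {y} 0<x 0<y = <-trans (<-respʳ-≈ (≈-sym (+-identityˡ y)) 0<y) (+-mono-< y 0<x)

  pos-inv : ∀ {x} → 0# < x → 0# < x ⁻¹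
  pos-inv {x} 0<x with compare 0# (x ⁻¹)
  ... | tri< 0<x⁻¹ _ _ = 0<x⁻¹
  ... | tri≈ _ 0≈x⁻¹ _ = ⊥-elim (irrefl 1≈0 0<1)
    where
    1≈0 : 0# ≈ 1#
    1≈0 = ≈-trans (≈-sym (zeroʳ x)) (≈-trans (*-cong ≈-refl 0≈x⁻¹) (inverseʳ 0<x))
  ... | tri> _ _ x⁻¹<0 = ⊥-elim (irrefl ≈-refl (<-trans 0<1 1<0))
    where
    open import Algebra.Properties.Ring (CommutativeRing.ring ring) using (-‿distribʳ-*)
    0<-x⁻¹ : 0# < - (x ⁻¹)
    0<-x⁻¹ = <-respʳ-≈ (+-identityˡ _) (<-respˡ-≈ (-‿inverseʳ (x ⁻¹)) (+-mono-< (- (x ⁻¹)) x⁻¹<0))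
    0<-1 : 0# < - 1#
    0<-1 = <-respʳ-≈ (≈-trans (≈-sym (-‿distribʳ-* x (x ⁻¹))) (-‿cong (inverseʳ 0<x))) (*-pos 0<x 0<-x⁻¹)
      where open CommutativeRing ring using (-‿cong)
    1<0 : 1# < 0#
    1<0 = <-respˡ-≈ (+-identityˡ _) (<-respʳ-≈ (-‿inverseˡ 1#) (+-mono-< 1# 0<-1))

  pos-factor : ∀ {x y} → 0# < y → 0# < x * y → 0# < x
  pos-factor {x} {y} 0<y 0<xy = pos-resp x≈ (*-pos 0<xy (pos-inv 0<y))
    where
    x≈ : x * y * y ⁻¹ ≈ x
    x≈ = ≈-trans (*-assoc _ _ _) (≈-trans (*-cong ≈-refl (inverseʳ 0<y)) (*-identityʳ x))

  inverse-unique : ∀ {y z} → 0# < y → y * z ≈ 1# → z ≈ y ⁻¹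
  inverse-unique {y} {z} 0<y yz≈1 = begin
    z                ≈⟨ ≈-sym (*-identityˡ z) ⟩
    1# * z           ≈⟨ *-cong (≈-sym (inverseˡ 0<y)) ≈-refl ⟩
    (y ⁻¹ * y) * z   ≈⟨ *-assoc _ _ _ ⟩
    y ⁻¹ * (y * z)   ≈⟨ *-cong ≈-refl yz≈1 ⟩
    y ⁻¹ * 1#        ≈⟨ *-identityʳ _ ⟩
    y ⁻¹             ∎

  inv-cong : ∀ {x y} → 0# < x → x ≈ y → x ⁻¹ ≈ y ⁻¹
  inv-cong 0<x x≈y = inverse-unique (pos-resp x≈y 0<x) (≈-trans (*-cong (≈-sym x≈y) ≈-refl) (inverseʳ 0<x))

  inv-cancel : ∀ {x y} → 0# < x → y ≈ x → x ⁻¹ * y ≈ 1#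
  inv-cancel 0<x y≈x = ≈-trans (*-cong ≈-refl y≈x) (inverseˡ 0<x)

  cancel-middle : ∀ l {s} w → 0# < s → l * s ⁻¹ * (s * w) ≈ l * w
  cancel-middle l {s} w 0<s = begin
    l * s ⁻¹ * (s * w)   ≈⟨ solve 4 (λ l s′ s w → (l ⊛ s′) ⊛ (s ⊛ w) ≐ (l ⊛ (s′ ⊛ s)) ⊛ w) ≈-refl l (s ⁻¹) s w ⟩
    l * (s ⁻¹ * s) * w   ≈⟨ *-cong (*-cong ≈-refl (inverseˡ 0<s)) ≈-refl ⟩
    l * 1# * w           ≈⟨ *-cong (*-identityʳ l) ≈-refl ⟩
    l * w                ∎

  harmonic : ∀ {z d} → 0# < z → 0# < d → (d ⁻¹ + z ⁻¹) * (z * d) ≈ z + d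
  harmonic {z} {d} 0<z 0<d = begin
    (d ⁻¹ + z ⁻¹) * (z * d)           ≈⟨ distribʳ _ _ _ ⟩
    d ⁻¹ * (z * d) + z ⁻¹ * (z * d)   ≈⟨ +-cong (solve 3 (λ d′ z d → d′ ⊛ (z ⊛ d) ≐ z ⊛ (d′ ⊛ d)) ≈-refl (d ⁻¹) z d)
                                                (solve 3 (λ z′ z d → z′ ⊛ (z ⊛ d) ≐ d ⊛ (z′ ⊛ z)) ≈-refl (z ⁻¹) z d) ⟩
    z * (d ⁻¹ * d) + d * (z ⁻¹ * z)   ≈⟨ +-cong (*-cong ≈-refl (inverseˡ 0<d)) (*-cong ≈-refl (inverseˡ 0<z)) ⟩
    z * 1# + d * 1#                   ≈⟨ +-cong (*-identityʳ z) (*-identityʳ d) ⟩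
    z + d                             ∎

  swap-quotients : ∀ {x y z w} → 0# < y → 0# < z → x * y ≈ z * w → x * z ⁻¹ ≈ w * y ⁻¹
  swap-quotients {x} {y} {z} {w} 0<y 0<z xy≈zw = begin
    x * z ⁻¹                ≈⟨ ≈-sym (*-identityʳ _) ⟩
    x * z ⁻¹ * 1#           ≈⟨ *-cong ≈-refl (≈-sym (inverseʳ 0<y)) ⟩
    x * z ⁻¹ * (y * y ⁻¹)   ≈⟨ solve 4 (λ x z′ y y′ → (x ⊛ z′) ⊛ (y ⊛ y′) ≐ ((x ⊛ y) ⊛ z′) ⊛ y′) ≈-refl x (z ⁻¹) y (y ⁻¹) ⟩
    x * y * z ⁻¹ * y ⁻¹     ≈⟨ *-cong (*-cong xy≈zw ≈-refl) ≈-refl ⟩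
    z * w * z ⁻¹ * y ⁻¹     ≈⟨ solve 4 (λ z w z′ y′ → ((z ⊛ w) ⊛ z′) ⊛ y′ ≐ (w ⊛ (z ⊛ z′)) ⊛ y′) ≈-refl z w (z ⁻¹) (y ⁻¹) ⟩
    w * (z * z ⁻¹) * y ⁻¹   ≈⟨ *-cong (*-cong ≈-refl (inverseʳ 0<z)) ≈-refl ⟩
    w * 1# * y ⁻¹           ≈⟨ *-cong (*-identityʳ w) ≈-refl ⟩
    w * y ⁻¹                ∎

-- A function on P̂ is read as a function of (row , column)
-- ∈ ℕ × ℕ, padded outside P.  The element of file k in row t has column
-- j with j + a = t + k, so we index the elements of a file by their row t
-- and their "diagonal" d = j + a = t + k.

module Grid {c ℓ} (R : RealNumbers c ℓ) (a b : ℕ) where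
  open Positive R
  open Order {a} {b}
  open FileToggle R {a} {b}
  open import Data.Fin using (fromℕ<)
  open import Data.Fin.Properties using (toℕ<n; toℕ-fromℕ<; fromℕ<-toℕ)
  module Sum  = BigOp +-commutativeMonoid
  module Prod = BigOp *-commutativeMonoid

  point : ∀ {t j} → t <ⁿ a → j <ⁿ b → P a b
  point t<a j<b = fromℕ< t<a , fromℕ< j<b

  cell : (P̂ a b → Carrier) → ℕ → ℕ → Carrier
  cell g t j with t ℕ.<? a | j ℕ.<? b
  ... | yes t<a | yes j<b = g (el (point t<a j<b))
  ... | _       | _       = 1#

  cell-el : ∀ g x → cell g (row x) (col x) ≡ g (el x)
  cell-el g (t , j) with toℕ t ℕ.<? a | toℕ j ℕ.<? b
  ... | yes t<a | yes j<b = cong (λ x → g (el x)) (cong₂ _,_ (fromℕ<-toℕ t t<a) (fromℕ<-toℕ j j<b))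
  ... | no t≮a  | _       = ⊥-elim (t≮a (toℕ<n t))
  ... | yes _   | no j≮b  = ⊥-elim (j≮b (toℕ<n j))

  cell-point : ∀ g {t j} (t<a : t <ⁿ a) (j<b : j <ⁿ b) → cell g t j ≡ g (el (point t<a j<b))
  cell-point g t<a j<b =
    ≡.trans (cong₂ (cell g) (≡.sym (toℕ-fromℕ< t<a)) (≡.sym (toℕ-fromℕ< j<b))) (cell-el g (point t<a j<b))

  cell-pos : ∀ g → (∀ z → 0# < g z) → ∀ t j → 0# < cell g t j
  cell-pos g pos t j with t ℕ.<? a | j ℕ.<? b
  ... | yes _ | yes _ = pos _
  ... | yes _ | no _  = 0<1
  ... | no _  | _     = 0<1

  InGrid : ℕ → ℕ → Set
  InGrid t d = t <ⁿ a × a ≤ⁿ d × d <ⁿ a +ⁿ b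

  inGrid : ℕ → ℕ → Bool
  inGrid t d = (t <ⁿᵇ a) ∧ (a ≤ᵇ d) ∧ (d <ⁿᵇ a +ⁿ b)

  inGrid-reflects : ∀ t d → Reflects (InGrid t d) (inGrid t d)
  inGrid-reflects t d = ℕₚ.<ᵇ-reflects-< t a ×-reflects ℕₚ.≤ᵇ-reflects-≤ a d ×-reflects ℕₚ.<ᵇ-reflects-< d (a +ⁿ b)

  onDiag : (ℕ → ℕ → Carrier) → ℕ → ℕ → Carrier
  onDiag V t d = if inGrid t d then V t (d ∸ a) else 1#

  inGrid-at : ∀ {t j} → t <ⁿ a → j <ⁿ b → InGrid t (j +ⁿ a)
  inGrid-at {t} {j} t<a j<b = t<a , ℕₚ.m≤n+m a j , ≡.subst (j +ⁿ a <ⁿ_) (ℕₚ.+-comm b a) (ℕₚ.+-monoˡ-< a j<b)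

  onDiag-at : ∀ V {t j} → t <ⁿ a → j <ⁿ b → onDiag V t (j +ⁿ a) ≡ V t j
  onDiag-at V {t} {j} t<a j<b = ≡.trans (if-yes (inGrid-reflects t _) (inGrid-at t<a j<b)) (cong (V t) (ℕₚ.m+n∸n≡m j a))

  onDiag-out : ∀ V {t d} → ¬ InGrid t d → onDiag V t d ≡ 1#
  onDiag-out V {t} {d} = if-no (inGrid-reflects t d)

  onDiag-pos : ∀ V → (∀ t j → 0# < V t j) → ∀ t d → 0# < onDiag V t d
  onDiag-pos V pos t d with inGrid t d
  ... | true  = pos t (d ∸ a)
  ... | false = 0<1

  on-file⇔on-diagonal : ∀ {t j k} → t ≤ⁿ j +ⁿ a → a ≤ⁿ t +ⁿ k → ((j +ⁿ a) ∸ t ≡ k) ⇔ (j ≡ (t +ⁿ k) ∸ a)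
  on-file⇔on-diagonal {t} {j} {k} t≤ a≤ = mk⇔
    (λ e → ≡.trans (≡.sym (ℕₚ.m+n∸n≡m j a)) (cong (_∸ a) (≡.trans (≡.sym (ℕₚ.m∸n+n≡m t≤)) (≡.trans (cong (_+ⁿ t) e) (ℕₚ.+-comm k t)))))
    (λ e → ≡.trans (cong (λ u → (u +ⁿ a) ∸ t) e) (≡.trans (cong (_∸ t) (ℕₚ.m∸n+n≡m a≤)) (ℕₚ.m+n∸m≡n t k)))

  diag→col : ∀ {d} → a ≤ⁿ d → d <ⁿ a +ⁿ b → d ∸ a <ⁿ b
  diag→col {d} a≤d d<a+b =
    ℕₚ.+-cancelʳ-< a (d ∸ a) b (≡.subst₂ _<ⁿ_ (≡.sym (ℕₚ.m∸n+n≡m a≤d)) (ℕₚ.+-comm a b) d<a+b)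

  col→diag : ∀ {d} → a ≤ⁿ d → d ∸ a <ⁿ b → d <ⁿ a +ⁿ b
  col→diag {d} a≤d col<b = ≡.subst₂ _<ⁿ_ (ℕₚ.m∸n+n≡m a≤d) (ℕₚ.+-comm b a) (ℕₚ.+-monoˡ-< a col<b)

  row-collapse : ∀ g k t → t <ⁿ a →
    Prod.big b (λ j → if (j +ⁿ a) ∸ t ≡ᵇ k then cell g t j else 1#) ≈ onDiag (cell g) t (t +ⁿ k)
  row-collapse g k t t<a with a ℕ.≤? t +ⁿ k
  ... | yes a≤d = begin
      Prod.big b (λ j → if (j +ⁿ a) ∸ t ≡ᵇ k then cell g t j else 1#)
        ≈⟨ Prod.big-cong b (λ j _ → ≈-reflexive (cong (λ c → if c then cell g t j else 1#) (indicator j))) ⟩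
      Prod.big b (λ j → if j ≡ᵇ m then cell g t j else 1#)
        ≈⟨ Prod.big-point b (cell g t) m ⟩
      (if m <ⁿᵇ b then cell g t m else 1#)
        ≡⟨ collapse ⟩
      onDiag (cell g) t (t +ⁿ k) ∎
    where
    m : ℕ
    m = (t +ⁿ k) ∸ a
    indicator : ∀ j → ((j +ⁿ a) ∸ t ≡ᵇ k) ≡ (j ≡ᵇ m)
    indicator j = det (reflects-map (Equivalence.to iff) (Equivalence.from iff) (≡ᵇ-reflects _ k)) (≡ᵇ-reflects j m)
      where iff = on-file⇔on-diagonal (ℕₚ.≤-trans (ℕₚ.<⇒≤ t<a) (ℕₚ.m≤n+m a j)) a≤d
    collapse : (if m <ⁿᵇ b then cell g t m else 1#) ≡ onDiag (cell g) t (t +ⁿ k)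
    collapse with decide (ℕₚ.<ᵇ-reflects-< m b)
    ... | yes m<b = ≡.trans (if-yes (ℕₚ.<ᵇ-reflects-< m b) m<b)
                            (≡.sym (if-yes (inGrid-reflects t _) (t<a , a≤d , col→diag a≤d m<b)))
    ... | no m≮b  = ≡.trans (if-no (ℕₚ.<ᵇ-reflects-< m b) m≮b)
                            (≡.sym (onDiag-out (cell g) (λ (_ , _ , d<a+b) → m≮b (diag→col a≤d d<a+b))))
  ... | no a≰d = ≈-trans (Prod.big-ε b (λ j _ → ≈-reflexive (if-no (≡ᵇ-reflects _ k) (λ e → a≰d (a≤ j e)))))
                         (≈-sym (≈-reflexive (onDiag-out (cell g) (λ (_ , a≤d , _) → a≰d a≤d))))
    where
    a≤ : ∀ j → (j +ⁿ a) ∸ t ≡ k → a ≤ⁿ t +ⁿ k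
    a≤ j e = ≡.subst (a ≤ⁿ_) (≡.trans (≡.sym (ℕₚ.m+[n∸m]≡n (ℕₚ.≤-trans (ℕₚ.<⇒≤ t<a) (ℕₚ.m≤n+m a j)))) (cong (t +ⁿ_) e))
                     (ℕₚ.m≤n+m a j)

  rows : (P̂ a b → Carrier) → ℕ → ℕ → Carrier
  rows g k t = onDiag (cell g) t (t +ⁿ k)

  file-product : ∀ g k → prodR (map (λ x → g (el x)) (fileElems a b k)) ≈ Prod.big a (rows g k)
  file-product g k = begin
    prodR (map (λ x → g (el x)) (fileElems a b k))
      ≈⟨ Prod.fold-filter (λ x → file x ≡ᵇ k) (λ x → g (el x)) (allP a b) ⟩
    Prod.fold (map (λ x → if file x ≡ᵇ k then g (el x) else 1#) (allP a b))
      ≈⟨ Prod.fold-allP _ (λ t j → if (j +ⁿ a) ∸ t ≡ᵇ k then cell g t j else 1#)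
           (λ t j → ≈-reflexive (cong (λ v → if file (t , j) ≡ᵇ k then v else 1#) (≡.sym (cell-el g (t , j))))) ⟩
    Prod.big² a b (λ t j → if (j +ⁿ a) ∸ t ≡ᵇ k then cell g t j else 1#)
      ≈⟨ Prod.big-cong a (λ t t<a → row-collapse g k t t<a) ⟩
    Prod.big a (rows g k) ∎

  end-reflects : ∀ k → Reflects (k ≡ 0 ⊎ k ≡ a +ⁿ b) ((k ≡ᵇ 0) ∨ (k ≡ᵇ (a +ⁿ b)))
  end-reflects k = ≡ᵇ-reflects k 0 ⊎-reflects ≡ᵇ-reflects k (a +ⁿ b)

  p-rows : ∀ g k → p g k ≈ Prod.big a (rows g k)
  p-rows g k with decide (end-reflects k)
  ... | yes end = ≈-trans (≈-reflexive (if-yes (end-reflects k) end))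
                          (≈-sym (Prod.big-ε a (λ t _ → ≈-reflexive (onDiag-out (cell g) (off-grid end)))))
    where
    off-grid : ∀ {t} → k ≡ 0 ⊎ k ≡ a +ⁿ b → ¬ InGrid t (t +ⁿ k)
    off-grid {t} (inj₁ refl) (t<a , a≤t+0 , _) = ℕₚ.<⇒≱ t<a (≡.subst (a ≤ⁿ_) (ℕₚ.+-identityʳ t) a≤t+0)
    off-grid {t} (inj₂ refl) (_ , _ , d<a+b)   = ℕₚ.<⇒≱ d<a+b (ℕₚ.m≤n+m (a +ⁿ b) t)
  ... | no ¬end = ≈-trans (≈-reflexive (if-no (end-reflects k) ¬end)) (file-product g k)

  inRange : (ℕ → ℕ → Carrier) → ℕ → ℕ → Carrier
  inRange V u v = if u <ⁿᵇ a then (if v <ⁿᵇ b then V u v else 0#) else 0#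

  inRange-in : ∀ V {u v} → u <ⁿ a → v <ⁿ b → inRange V u v ≡ V u v
  inRange-in V {u} {v} u<a v<b = ≡.trans (if-yes (ℕₚ.<ᵇ-reflects-< u a) u<a) (if-yes (ℕₚ.<ᵇ-reflects-< v b) v<b)

  inRange-row : ∀ V {u v} → ¬ u <ⁿ a → inRange V u v ≡ 0#
  inRange-row V {u} = if-no (ℕₚ.<ᵇ-reflects-< u a)

  inRange-col : ∀ V {u v} → ¬ v <ⁿ b → inRange V u v ≡ 0#
  inRange-col V {u} {v} v≮b with decide (ℕₚ.<ᵇ-reflects-< u a)
  ... | yes u<a = ≡.trans (if-yes (ℕₚ.<ᵇ-reflects-< u a) u<a) (if-no (ℕₚ.<ᵇ-reflects-< v b) v≮b)
  ... | no u≮a  = inRange-row V u≮a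

  prevRow prevCol : (ℕ → ℕ → Carrier) → ℕ → ℕ → Carrier
  prevRow V zero    j = 0#
  prevRow V (suc t) j = inRange V t j
  prevCol V t zero    = 0#
  prevCol V t (suc j) = inRange V t j

  lower-steps : ∀ V t j →
    Sum.big² a b (λ t′ j′ → if stepᵇ t′ j′ t j then V t′ j′ else 0#) ≈ prevRow V t j + prevCol V t j
  lower-steps V t j = ≈-trans (Sum.big²-cong a b (λ t′ j′ _ _ → Sum.if-∨ (row-step t′ j′) (col-step t′ j′) (V t′ j′) (disjoint t′ j′)))
                              (≈-trans (Sum.big²-∙ a b (λ t′ j′ → if row-step t′ j′ then V t′ j′ else 0#)
                                                       (λ t′ j′ → if col-step t′ j′ then V t′ j′ else 0#))
                                       (+-cong (by-row t) (by-col j)))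
    where
    row-step col-step : ℕ → ℕ → Bool
    row-step t′ j′ = (suc t′ ≡ᵇ t) ∧ (j′ ≡ᵇ j)
    col-step t′ j′ = (t′ ≡ᵇ t) ∧ (suc j′ ≡ᵇ j)
    disjoint : ∀ t′ j′ → ¬ (T (row-step t′ j′) × T (col-step t′ j′))
    disjoint t′ j′ (h₁ , h₂) = ℕₚ.1+n≢n (≡.trans (ℕₚ.≡ᵇ⇒≡ (suc t′) t (proj₁ (Equivalence.to (T-∧ {suc t′ ≡ᵇ t}) h₁)))
                                                (≡.sym (ℕₚ.≡ᵇ⇒≡ t′ t (proj₁ (Equivalence.to (T-∧ {t′ ≡ᵇ t}) h₂)))))
    by-row : ∀ u → Sum.big² a b (λ t′ j′ → if (suc t′ ≡ᵇ u) ∧ (j′ ≡ᵇ j) then V t′ j′ else 0#) ≈ prevRow V u j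
    by-row zero    = Sum.big²-ε a b (λ _ _ → ≈-refl)
    by-row (suc u) = Sum.grid-point a b V u j
    by-col : ∀ v → Sum.big² a b (λ t′ j′ → if (t′ ≡ᵇ t) ∧ (suc j′ ≡ᵇ v) then V t′ j′ else 0#) ≈ prevCol V t v
    by-col zero    = Sum.big²-ε a b (λ t′ j′ → ≈-reflexive (cong (λ c → if c then V t′ j′ else 0#) (∧-zeroʳ (t′ ≡ᵇ t))))
    by-col (suc v) = Sum.grid-point a b V t v

  upper-steps : ∀ V t j →
    Sum.big² a b (λ t′ j′ → if stepᵇ t j t′ j′ then V t′ j′ else 0#) ≈ inRange V (suc t) j + inRange V t (suc j)
  upper-steps V t j = ≈-trans (Sum.big²-cong a b (λ t′ j′ _ _ → Sum.if-∨ (row-step t′ j′) (col-step t′ j′) (V t′ j′) (disjoint t′ j′)))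
                              (≈-trans (Sum.big²-∙ a b (λ t′ j′ → if row-step t′ j′ then V t′ j′ else 0#)
                                                       (λ t′ j′ → if col-step t′ j′ then V t′ j′ else 0#))
                                       (+-cong (flipped-point (suc t) j) (flipped-point t (suc j))))
    where
    row-step col-step : ℕ → ℕ → Bool
    row-step t′ j′ = (suc t ≡ᵇ t′) ∧ (j ≡ᵇ j′)
    col-step t′ j′ = (t ≡ᵇ t′) ∧ (suc j ≡ᵇ j′)
    disjoint : ∀ t′ j′ → ¬ (T (row-step t′ j′) × T (col-step t′ j′))
    disjoint t′ j′ (h₁ , h₂) = ℕₚ.1+n≢n (≡.trans (ℕₚ.≡ᵇ⇒≡ (suc t) t′ (proj₁ (Equivalence.to (T-∧ {suc t ≡ᵇ t′}) h₁)))
                                                (≡.sym (ℕₚ.≡ᵇ⇒≡ t t′ (proj₁ (Equivalence.to (T-∧ {t ≡ᵇ t′}) h₂)))))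
    flipped-point : ∀ u v → Sum.big² a b (λ t′ j′ → if (u ≡ᵇ t′) ∧ (v ≡ᵇ j′) then V t′ j′ else 0#) ≈ inRange V u v
    flipped-point u v = ≈-trans (Sum.big²-cong a b (λ t′ j′ _ _ → ≈-reflexive
                                  (cong₂ (λ c c′ → if c ∧ c′ then V t′ j′ else 0#) (≡ᵇ-sym u t′) (≡ᵇ-sym v j′))))
                                (Sum.grid-point a b V u v)

  Lform : (P̂ a b → Carrier) → ℕ → ℕ → Carrier
  Lform g zero    zero    = g 0̂
  Lform g (suc t) zero    = cell g t 0
  Lform g zero    (suc j) = cell g 0 j
  Lform g (suc t) (suc j) = cell g t (suc j) + cell g (suc t) j

  lowerSum-coords : ∀ g x → lowerSum g x ≈ Lform g (row x) (col x)
  lowerSum-coords g x = begin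
    lowerSum g x
      ≈⟨ Sum.fold-filter (λ z → z ⋖ᵇ el x) g (allP̂ a b) ⟩
    (if 0̂ ⋖ᵇ el x then g 0̂ else 0#) + (0# + Sum.fold (map (λ z → if z ⋖ᵇ el x then g z else 0#) (map el (allP a b))))
      ≈⟨ +-cong (≈-reflexive (cong (λ c → if c then g 0̂ else 0#) (cover-0̂ x))) (+-identityˡ _) ⟩
    origin + Sum.fold (map (λ z → if z ⋖ᵇ el x then g z else 0#) (map el (allP a b)))
      ≈⟨ +-cong ≈-refl (≈-reflexive (cong Sum.fold (≡.sym (Data.List.Properties.map-∘ (allP a b))))) ⟩
    origin + Sum.fold (map (λ w → if el w ⋖ᵇ el x then g (el w) else 0#) (allP a b))
      ≈⟨ +-cong ≈-refl (Sum.fold-allP _ _ (λ t′ j′ → ≈-reflexive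
           (cong₂ (λ c v → if c then v else 0#) (cover-el (t′ , j′) x) (≡.sym (cell-el g (t′ , j′)))))) ⟩
    origin + Sum.big² a b (λ t′ j′ → if stepᵇ t′ j′ (row x) (col x) then cell g t′ j′ else 0#)
      ≈⟨ +-cong ≈-refl (lower-steps (cell g) (row x) (col x)) ⟩
    origin + (prevRow (cell g) (row x) (col x) + prevCol (cell g) (row x) (col x))
      ≈⟨ by-position (row x) (col x) (toℕ<n (proj₁ x)) (toℕ<n (proj₂ x)) ⟩
    Lform g (row x) (col x) ∎
    where
    import Data.List.Properties
    origin : Carrier
    origin = if (row x ≡ᵇ 0) ∧ (col x ≡ᵇ 0) then g 0̂ else 0#
    by-position : ∀ t j → t <ⁿ a → j <ⁿ b →
      (if (t ≡ᵇ 0) ∧ (j ≡ᵇ 0) then g 0̂ else 0#) + (prevRow (cell g) t j + prevCol (cell g) t j) ≈ Lform g t j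
    by-position zero    zero    _ _ = ≈-trans (+-cong ≈-refl (+-identityʳ 0#)) (+-identityʳ _)
    by-position (suc t) zero    t<a 0<b = ≈-trans (+-identityˡ _) (≈-trans (+-identityʳ _)
      (≈-reflexive (inRange-in (cell g) (ℕₚ.<-trans (ℕₚ.n<1+n t) t<a) 0<b)))
    by-position zero    (suc j) 0<a j<b = ≈-trans (+-identityˡ _) (≈-trans (+-identityˡ _)
      (≈-reflexive (inRange-in (cell g) 0<a (ℕₚ.<-trans (ℕₚ.n<1+n j) j<b))))
    by-position (suc t) (suc j) t<a j<b = ≈-trans (+-identityˡ _) (+-cong
      (≈-reflexive (inRange-in (cell g) (ℕₚ.<-trans (ℕₚ.n<1+n t) t<a) j<b))
      (≈-reflexive (inRange-in (cell g) t<a (ℕₚ.<-trans (ℕₚ.n<1+n j) j<b))))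

  invCell : (P̂ a b → Carrier) → ℕ → ℕ → Carrier
  invCell g t j = cell g t j ⁻¹

  Sform : (P̂ a b → Carrier) → ℕ → ℕ → Carrier
  Sform g t j = (if (suc t ≡ᵇ a) ∧ (suc j ≡ᵇ b) then g 1̂ ⁻¹ else 0#) +
                (inRange (invCell g) (suc t) j + inRange (invCell g) t (suc j))

  upperInv : (P̂ a b → Carrier) → P a b → Carrier
  upperInv g x = sumR (map _⁻¹ (map g (filterᵇ (λ z → el x ⋖ᵇ z) (allP̂ a b))))

  upperInv-coords : ∀ g x → upperInv g x ≈ Sform g (row x) (col x)
  upperInv-coords g x = begin
    upperInv g x
      ≡⟨ cong sumR (≡.sym (map-∘ (filterᵇ (λ z → el x ⋖ᵇ z) (allP̂ a b)))) ⟩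
    sumR (map (λ z → g z ⁻¹) (filterᵇ (λ z → el x ⋖ᵇ z) (allP̂ a b)))
      ≈⟨ Sum.fold-filter (λ z → el x ⋖ᵇ z) (λ z → g z ⁻¹) (allP̂ a b) ⟩
    0# + ((if el x ⋖ᵇ 1̂ then g 1̂ ⁻¹ else 0#) + Sum.fold (map (λ z → if el x ⋖ᵇ z then g z ⁻¹ else 0#) (map el (allP a b))))
      ≈⟨ +-identityˡ _ ⟩
    _ ≈⟨ +-cong (≈-reflexive (cong (λ c → if c then g 1̂ ⁻¹ else 0#) (cover-1̂ x)))
               (≈-trans (≈-reflexive (cong Sum.fold (≡.sym (map-∘ (allP a b)))))
                        (Sum.fold-allP _ _ (λ t′ j′ → ≈-reflexive
                          (cong₂ (λ c v → if c then v ⁻¹ else 0#) (cover-el x (t′ , j′)) (≡.sym (cell-el g (t′ , j′))))))) ⟩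
    _ ≈⟨ +-cong ≈-refl (upper-steps (invCell g) (row x) (col x)) ⟩
    Sform g (row x) (col x) ∎
    where open import Data.List.Properties using (map-∘)

  corner-reflects : ∀ t j → Reflects (suc t ≡ a × suc j ≡ b) ((suc t ≡ᵇ a) ∧ (suc j ≡ᵇ b))
  corner-reflects t j = ≡ᵇ-reflects (suc t) a ×-reflects ≡ᵇ-reflects (suc j) b

  Sform-inner : ∀ g {t j} → suc t <ⁿ a → suc j <ⁿ b → Sform g t j ≈ invCell g (suc t) j + invCell g t (suc j)
  Sform-inner g {t} {j} st<a sj<b = ≈-trans (+-cong (≈-reflexive (if-no (corner-reflects t j) (λ (e , _) → ℕₚ.<-irrefl e st<a)))
    (+-cong (≈-reflexive (inRange-in (invCell g) st<a (ℕₚ.<-trans (ℕₚ.n<1+n j) sj<b)))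
            (≈-reflexive (inRange-in (invCell g) (ℕₚ.<-trans (ℕₚ.n<1+n t) st<a) sj<b)))) (+-identityˡ _)

  Sform-lastRow : ∀ g {t j} → suc t ≡ a → suc j <ⁿ b → Sform g t j ≈ invCell g t (suc j)
  Sform-lastRow g {t} {j} st≡a sj<b = ≈-trans (+-cong (≈-reflexive (if-no (corner-reflects t j) (λ (_ , e) → ℕₚ.<-irrefl e sj<b)))
    (+-cong (≈-reflexive (inRange-row (invCell g) (λ st<a → ℕₚ.<-irrefl st≡a st<a)))
            (≈-reflexive (inRange-in (invCell g) (≡.subst (t <ⁿ_) st≡a (ℕₚ.n<1+n t)) sj<b))))
    (≈-trans (+-identityˡ _) (+-identityˡ _))

  Sform-lastCol : ∀ g {t j} → suc t <ⁿ a → suc j ≡ b → Sform g t j ≈ invCell g (suc t) j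
  Sform-lastCol g {t} {j} st<a sj≡b = ≈-trans (+-cong (≈-reflexive (if-no (corner-reflects t j) (λ (e , _) → ℕₚ.<-irrefl e st<a)))
    (+-cong (≈-reflexive (inRange-in (invCell g) st<a (≡.subst (j <ⁿ_) sj≡b (ℕₚ.n<1+n j))))
            (≈-reflexive (inRange-col (invCell g) (λ sj<b → ℕₚ.<-irrefl sj≡b sj<b)))))
    (≈-trans (+-identityˡ _) (+-identityʳ _))

  Sform-corner : ∀ g {t j} → suc t ≡ a → suc j ≡ b → Sform g t j ≈ g 1̂ ⁻¹
  Sform-corner g {t} {j} st≡a sj≡b = ≈-trans (+-cong (≈-reflexive (if-yes (corner-reflects t j) (st≡a , sj≡b)))
    (+-cong (≈-reflexive (inRange-row (invCell g) (λ st<a → ℕₚ.<-irrefl st≡a st<a)))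
            (≈-reflexive (inRange-col (invCell g) (λ sj<b → ℕₚ.<-irrefl sj≡b sj<b)))))
    (≈-trans (+-cong ≈-refl (+-identityʳ 0#)) (+-identityʳ _))

  onDiag-lastRow : ∀ V {t d} → ¬ t <ⁿ a → onDiag V t d ≡ 1#
  onDiag-lastRow V t≮a = onDiag-out V (λ (t<a , _) → t≮a t<a)

  onDiag-lastCol : ∀ V {t j} → ¬ j <ⁿ b → onDiag V t (j +ⁿ a) ≡ 1#
  onDiag-lastCol V {t} {j} j≮b = onDiag-out V (λ (_ , a≤d , d<a+b) →
    j≮b (≡.subst (_<ⁿ b) (ℕₚ.m+n∸n≡m j a) (diag→col a≤d d<a+b)))

-- Fix f with f(0̂) = f(1̂) = 1.  For x
-- on a file s ≥ 1 write E, N, A for the values of f, L and L/S along the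
-- diagonals.  The upper covers of x and the lower covers of the next
-- element x + (1,1) of the file are the same points, which gives
--   A(x) · N(x + (1,1)) = N(x) · (product of f over the upper covers of x),
-- padded consistently at the boundary of P.

module Diagonals {c ℓ} (R : RealNumbers c ℓ) {a b : ℕ} (0<a : 0 <ⁿ a) (0<b : 0 <ⁿ b) where
  open Positive R
  open Order {a} {b}
  open FileToggle R {a} {b}
  open Grid R a b
  open import Data.Fin.Properties using (toℕ<n; toℕ-fromℕ<)

  module _ (f : P̂ a b → Carrier) (pos : ∀ z → 0# < f z) (f0̂ : f 0̂ ≈ 1#) (f1̂ : f 1̂ ≈ 1#) where

    LR : ℕ → ℕ → Carrier
    LR t j = Lform f t j * Sform f t j ⁻¹

    E N A : ℕ → ℕ → Carrier
    E = onDiag (cell f)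
    N = onDiag (Lform f)
    A = onDiag LR

    Lform-pos : ∀ t j → 0# < Lform f t j
    Lform-pos zero    zero    = pos 0̂
    Lform-pos (suc t) zero    = cell-pos f pos t 0
    Lform-pos zero    (suc j) = cell-pos f pos 0 j
    Lform-pos (suc t) (suc j) = pos-+ (cell-pos f pos t (suc j)) (cell-pos f pos (suc t) j)

    E-pos : ∀ t d → 0# < E t d
    E-pos = onDiag-pos (cell f) (cell-pos f pos)

    upper-identity : ∀ {t j} → t <ⁿ a → j <ⁿ b →
      Sform f t j * (E t (suc j +ⁿ a) * E (suc t) (j +ⁿ a)) ≈ N (suc t) (suc j +ⁿ a)
    upper-identity {t} {j} t<a j<b with ℕₚ.m≤n⇒m<n∨m≡n t<a | ℕₚ.m≤n⇒m<n∨m≡n j<b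
    ... | inj₁ st<a | inj₁ sj<b = begin
      Sform f t j * (E t (suc j +ⁿ a) * E (suc t) (j +ⁿ a))
        ≈⟨ *-cong (Sform-inner f st<a sj<b) (*-cong (≈-reflexive (onDiag-at (cell f) t<a sj<b))
                                                   (≈-reflexive (onDiag-at (cell f) st<a j<b))) ⟩
      (invCell f (suc t) j + invCell f t (suc j)) * (cell f t (suc j) * cell f (suc t) j)
        ≈⟨ harmonic (cell-pos f pos t (suc j)) (cell-pos f pos (suc t) j) ⟩
      cell f t (suc j) + cell f (suc t) j
        ≡⟨ ≡.sym (onDiag-at (Lform f) st<a sj<b) ⟩
      N (suc t) (suc j +ⁿ a) ∎
    ... | inj₂ st≡a | inj₁ sj<b = ≈-trans
      (*-cong (Sform-lastRow f st≡a sj<b) (*-cong (≈-reflexive (onDiag-at (cell f) t<a sj<b))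
                                                 (≈-reflexive (onDiag-lastRow (cell f) (ℕₚ.<-irrefl st≡a)))))
      (≈-trans (inv-cancel (cell-pos f pos t (suc j)) (*-identityʳ _))
               (≈-sym (≈-reflexive (onDiag-lastRow (Lform f) (ℕₚ.<-irrefl st≡a)))))
    ... | inj₁ st<a | inj₂ sj≡b = ≈-trans
      (*-cong (Sform-lastCol f st<a sj≡b) (*-cong (≈-reflexive (onDiag-lastCol (cell f) (ℕₚ.<-irrefl sj≡b)))
                                                 (≈-reflexive (onDiag-at (cell f) st<a j<b))))
      (≈-trans (inv-cancel (cell-pos f pos (suc t) j) (*-identityˡ _))
               (≈-sym (≈-reflexive (onDiag-lastCol (Lform f) (ℕₚ.<-irrefl sj≡b)))))
    ... | inj₂ st≡a | inj₂ sj≡b = ≈-trans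
      (*-cong (Sform-corner f st≡a sj≡b) (*-cong (≈-reflexive (onDiag-lastCol (cell f) (ℕₚ.<-irrefl sj≡b)))
                                                (≈-reflexive (onDiag-lastRow (cell f) (ℕₚ.<-irrefl st≡a)))))
      (≈-trans (inv-cancel (pos 1̂) (≈-trans (*-identityʳ 1#) (≈-sym f1̂)))
               (≈-sym (≈-reflexive (onDiag-lastRow (Lform f) (ℕₚ.<-irrefl st≡a)))))

    Sform-pos : ∀ {t j} → t <ⁿ a → j <ⁿ b → 0# < Sform f t j
    Sform-pos t<a j<b = pos-factor (*-pos (E-pos _ _) (E-pos _ _))
                                   (pos-resp (≈-sym (upper-identity t<a j<b)) (onDiag-pos (Lform f) Lform-pos _ _))

    local-in : ∀ {t j} → t <ⁿ a → j <ⁿ b →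
      A t (j +ⁿ a) * N (suc t) (suc j +ⁿ a) ≈ N t (j +ⁿ a) * (E t (suc j +ⁿ a) * E (suc t) (j +ⁿ a))
    local-in {t} {j} t<a j<b = begin
      A t (j +ⁿ a) * N (suc t) (suc j +ⁿ a)  ≈⟨ *-cong (≈-reflexive (onDiag-at LR t<a j<b)) (≈-sym (upper-identity t<a j<b)) ⟩
      Lform f t j * Sform f t j ⁻¹ * (Sform f t j * W)
                                             ≈⟨ cancel-middle (Lform f t j) W (Sform-pos t<a j<b) ⟩
      Lform f t j * W                        ≡⟨ cong (_* W) (≡.sym (onDiag-at (Lform f) t<a j<b)) ⟩
      N t (j +ⁿ a) * W                       ∎
      where W = E t (suc j +ⁿ a) * E (suc t) (j +ⁿ a)

    -- where a file enters P at column 0, the only lower cover of (t + 1 , 0) is (t , 0)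
    entering : ∀ {t d} → t <ⁿ d → d <ⁿ a → N (suc t) (suc d) ≡ E t (suc d)
    entering {t} {d} t<d d<a with ℕₚ.m≤n⇒m<n∨m≡n d<a
    ... | inj₁ sd<a = ≡.trans (onDiag-out (Lform f) before) (≡.sym (onDiag-out (cell f) before))
      where
      before : ∀ {u} → ¬ InGrid u (suc d)
      before (_ , a≤sd , _) = ℕₚ.<⇒≱ sd<a a≤sd
    ... | inj₂ sd≡a =
      ≡.trans (cong (N (suc t)) sd≡a)
        (≡.trans (onDiag-at (Lform f) (ℕₚ.<-≤-trans (s<s t<d) (ℕₚ.≤-reflexive sd≡a)) 0<b)
          (≡.trans (≡.sym (onDiag-at (cell f) (ℕₚ.<-trans t<d d<a) 0<b)) (cong (E t) (≡.sym sd≡a))))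

    local-before : ∀ {t d} → t <ⁿ d → d <ⁿ a → A t d * N (suc t) (suc d) ≈ N t d * (E t (suc d) * E (suc t) d)
    local-before {t} {d} t<d d<a = begin
      A t d * N (suc t) (suc d)      ≈⟨ *-cong (≈-reflexive (onDiag-out LR before)) (≈-reflexive (entering t<d d<a)) ⟩
      1# * E t (suc d)               ≈⟨ *-cong ≈-refl (≈-sym (*-identityʳ _)) ⟩
      1# * (E t (suc d) * 1#)        ≈⟨ *-cong (≈-reflexive (≡.sym (onDiag-out (Lform f) before)))
                                               (*-cong ≈-refl (≈-reflexive (≡.sym (onDiag-out (cell f) before)))) ⟩
      N t d * (E t (suc d) * E (suc t) d) ∎
      where
      before : ∀ {u} → ¬ InGrid u d
      before (_ , a≤d , _) = ℕₚ.<⇒≱ d<a a≤d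

    local-after : ∀ {t d} → a +ⁿ b ≤ⁿ d → A t d * N (suc t) (suc d) ≈ N t d * (E t (suc d) * E (suc t) d)
    local-after {t} {d} a+b≤d = begin
      A t d * N (suc t) (suc d)           ≈⟨ *-cong (≈-reflexive (onDiag-out LR (past ℕₚ.≤-refl)))
                                                    (≈-reflexive (onDiag-out (Lform f) (past (ℕₚ.n≤1+n d)))) ⟩
      1# * 1#                             ≈⟨ *-cong ≈-refl (≈-sym (*-identityʳ 1#)) ⟩
      1# * (1# * 1#)                      ≈⟨ *-cong (≈-reflexive (≡.sym (onDiag-out (Lform f) (past ℕₚ.≤-refl))))
                                                    (*-cong (≈-reflexive (≡.sym (onDiag-out (cell f) (past (ℕₚ.n≤1+n d)))))
                                                            (≈-reflexive (≡.sym (onDiag-out (cell f) (past ℕₚ.≤-refl))))) ⟩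
      N t d * (E t (suc d) * E (suc t) d) ∎
      where
      past : ∀ {u e} → d ≤ⁿ e → ¬ InGrid u e
      past d≤e (_ , _ , e<a+b) = ℕₚ.<⇒≱ e<a+b (ℕₚ.≤-trans a+b≤d d≤e)

    local : ∀ {t d} → t <ⁿ a → t <ⁿ d → A t d * N (suc t) (suc d) ≈ N t d * (E t (suc d) * E (suc t) d)
    local {t} {d} t<a t<d with a ℕ.≤? d
    ... | no a≰d = local-before t<d (ℕₚ.≰⇒> a≰d)
    ... | yes a≤d with d ℕ.<? a +ⁿ b
    ...   | no d≮a+b  = local-after (ℕₚ.≮⇒≥ d≮a+b)
    ...   | yes d<a+b = ≡.subst (λ d → A t d * N (suc t) (suc d) ≈ N t d * (E t (suc d) * E (suc t) d))
                                (ℕₚ.m∸n+n≡m a≤d) (local-in t<a (diag→col a≤d d<a+b))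

    toggled-product : ∀ x → toggled f x * f (el x) ≈ LR (row x) (col x)
    toggled-product x = begin
      lowerSum f x * upperPar f x * f (el x) ⁻¹ * f (el x)    ≈⟨ *-assoc _ _ _ ⟩
      lowerSum f x * upperPar f x * (f (el x) ⁻¹ * f (el x))  ≈⟨ *-cong ≈-refl (inverseˡ (pos _)) ⟩
      lowerSum f x * upperPar f x * 1#                        ≈⟨ *-identityʳ _ ⟩
      lowerSum f x * upperInv f x ⁻¹                          ≈⟨ *-cong (lowerSum-coords f x) (inv-cong 0<S (upperInv-coords f x)) ⟩
      LR (row x) (col x)                                      ∎
      where
      0<S : 0# < upperInv f x
      0<S = pos-resp (≈-sym (upperInv-coords f x)) (Sform-pos (toℕ<n (proj₁ x)) (toℕ<n (proj₂ x)))

    toggle-row : ∀ s t → onDiag (cell (φ* s f)) t (t +ⁿ s) * E t (t +ⁿ s) ≈ A t (t +ⁿ s)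
    toggle-row s t with decide (inGrid-reflects t (t +ⁿ s))
    ... | no off = ≈-trans (*-cong (≈-reflexive (onDiag-out (cell (φ* s f)) off)) (≈-reflexive (onDiag-out (cell f) off)))
                           (≈-trans (*-identityˡ 1#) (≈-sym (≈-reflexive (onDiag-out LR off))))
    ... | yes on@(t<a , a≤d , d<a+b) = begin
      onDiag (cell φf) t d * E t d  ≡⟨ cong₂ _*_ (if-yes (inGrid-reflects t d) on) (if-yes (inGrid-reflects t d) on) ⟩
      cell φf t j * cell f t j      ≡⟨ cong₂ _*_ (cell-point φf t<a j<b) (cell-point f t<a j<b) ⟩
      φf (el x) * f (el x)          ≡⟨ cong (_* f (el x)) (φ*-on s f x file-x) ⟩
      toggled f x * f (el x)        ≈⟨ toggled-product x ⟩
      LR (row x) (col x)            ≡⟨ cong₂ LR (toℕ-fromℕ< t<a) (toℕ-fromℕ< j<b) ⟩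
      LR t j                        ≡⟨ ≡.sym (if-yes (inGrid-reflects t d) on) ⟩
      A t d                         ∎
      where
      φf : P̂ a b → Carrier
      φf = φ* s f
      d j : ℕ
      d = t +ⁿ s
      j = d ∸ a
      j<b : j <ⁿ b
      j<b = diag→col a≤d d<a+b
      x : P a b
      x = point t<a j<b
      file-x : file x ≡ s
      file-x = ≡.trans (cong₂ (λ r c → (c +ⁿ a) ∸ r) (toℕ-fromℕ< t<a) (toℕ-fromℕ< j<b))
                       (≡.trans (cong (_∸ t) (ℕₚ.m∸n+n≡m a≤d)) (ℕₚ.m+n∸m≡n t s))

    -- row 0: N on file s′ + 1 agrees with E on file s′ (this is where f 0̂ = 1 is used)
    first-row : ∀ s′ → suc s′ <ⁿ a +ⁿ b → N 0 (suc s′) ≈ E 0 s′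
    first-row s′ s<a+b with ℕₚ.<-cmp (suc s′) a
    ... | tri< s<a _ _ = ≈-reflexive (≡.trans (onDiag-out (Lform f) (λ (_ , a≤s , _) → ℕₚ.<⇒≱ s<a a≤s))
                                              (≡.sym (onDiag-out (cell f) (λ (_ , a≤s′ , _) → ℕₚ.<⇒≱ (ℕₚ.<-trans (ℕₚ.n<1+n s′) s<a) a≤s′))))
    ... | tri≈ _ s≡a _ = begin
      N 0 (suc s′)  ≡⟨ cong (N 0) s≡a ⟩
      N 0 a         ≡⟨ onDiag-at (Lform f) 0<a 0<b ⟩
      f 0̂           ≈⟨ f0̂ ⟩
      1#            ≡⟨ ≡.sym (onDiag-out (cell f) (λ (_ , a≤s′ , _) → ℕₚ.<⇒≱ (≡.subst (s′ <ⁿ_) s≡a (ℕₚ.n<1+n s′)) a≤s′)) ⟩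
      E 0 s′        ∎
    ... | tri> _ _ a<s = ≡.subst (λ e → N 0 (suc e) ≈ E 0 e) (ℕₚ.m∸n+n≡m a≤s′) (interior (s′ ∸ a) sj<b)
      where
      a≤s′ : a ≤ⁿ s′
      a≤s′ = ℕₚ.≤-pred a<s
      sj<b : suc (s′ ∸ a) <ⁿ b
      sj<b = ℕₚ.+-cancelʳ-< a (suc (s′ ∸ a)) b
               (≡.subst₂ (λ u v → suc u <ⁿ v) (≡.sym (ℕₚ.m∸n+n≡m a≤s′)) (ℕₚ.+-comm a b) s<a+b)
      interior : ∀ j → suc j <ⁿ b → N 0 (suc j +ⁿ a) ≈ E 0 (j +ⁿ a)
      interior j sj<b = ≈-reflexive (≡.trans (onDiag-at (Lform f) 0<a sj<b)
                                             (≡.sym (onDiag-at (cell f) 0<a (ℕₚ.<-trans (ℕₚ.n<1+n j) sj<b))))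

    key : ∀ s′ → suc s′ <ⁿ a +ⁿ b →
      p (φ* (suc s′) f) (suc s′) * p f (suc s′) ≈ p f s′ * p f (suc (suc s′))
    key s′ s<a+b = begin
      p (φ* s f) s * p f s          ≈⟨ toggled-file ⟩
      Prod.big a Aₛ                  ≈⟨ ≈-sym (*-identityʳ _) ⟩
      Prod.big a Aₛ * 1#             ≈⟨ *-cong ≈-refl (≈-sym (≈-reflexive (onDiag-lastRow (Lform f) (ℕₚ.<-irrefl refl)))) ⟩
      Prod.big a Aₛ * N a (a +ⁿ s)   ≈⟨ Prod.telescope a Aₛ (λ t → Z t * E (suc t) (t +ⁿ s)) (λ t → N t (t +ⁿ s))
                                                      (λ t t<a → local t<a (ℕₚ.m<m+n t z<s)) ⟩
      N 0 s * Prod.big a (λ t → Z t * E (suc t) (t +ⁿ s))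
                                     ≈⟨ *-cong ≈-refl (Prod.big-∙ a Z (λ t → E (suc t) (t +ⁿ s))) ⟩
      N 0 s * (Prod.big a Z * Prod.big a (λ t → E (suc t) (t +ⁿ s)))
                                     ≈⟨ solve 3 (λ n z d → n ⊛ (z ⊛ d) ≐ (n ⊛ d) ⊛ z) ≈-refl _ _ _ ⟩
      N 0 s * Prod.big a (λ t → E (suc t) (t +ⁿ s)) * Prod.big a Z
                                     ≈⟨ *-cong previous-file next-file ⟩
      p f s′ * p f (suc s)           ∎
      where
      s : ℕ
      s = suc s′
      Aₛ Z : ℕ → Carrier
      Aₛ t = A t (t +ⁿ s)
      Z t = E t (suc (t +ⁿ s))
      toggled-file : p (φ* s f) s * p f s ≈ Prod.big a Aₛ
      toggled-file = ≈-trans (*-cong (p-rows (φ* s f) s) (p-rows f s))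
                             (≈-trans (≈-sym (Prod.big-∙ a (rows (φ* s f) s) (rows f s)))
                                      (Prod.big-cong a (λ t _ → toggle-row s t)))
      next-file : Prod.big a Z ≈ p f (suc s)
      next-file = ≈-trans (Prod.big-cong a (λ t _ → ≈-reflexive (cong (E t) (≡.sym (ℕₚ.+-suc t s)))))
                          (≈-sym (p-rows f (suc s)))
      -- N at row 0 of file s continues the rows of file s′ = s - 1 from row 1 on
      previous-file : N 0 s * Prod.big a (λ t → E (suc t) (t +ⁿ s)) ≈ p f s′
      previous-file = begin
        N 0 s * Prod.big a (λ t → E (suc t) (t +ⁿ s))
          ≈⟨ *-cong (first-row s′ s<a+b) (Prod.big-cong a (λ t _ → ≈-reflexive (cong (E (suc t)) (ℕₚ.+-suc t s′)))) ⟩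
        Prod.big (suc a) (rows f s′)          ≈⟨ Prod.big-last a (rows f s′) ⟩
        Prod.big a (rows f s′) * E a (a +ⁿ s′) ≈⟨ *-cong ≈-refl (≈-reflexive (onDiag-lastRow (cell f) (ℕₚ.<-irrefl refl))) ⟩
        Prod.big a (rows f s′) * 1#           ≈⟨ *-identityʳ _ ⟩
        Prod.big a (rows f s′)                ≈⟨ ≈-sym (p-rows f s′) ⟩
        p f s′                                ∎

σ-at : ∀ i → σ i i ≡ suc i
σ-at i = if-yes (≡ᵇ-reflects i i) refl

σ-next : ∀ i → σ i (suc i) ≡ i
σ-next i = ≡.trans (if-no (≡ᵇ-reflects (suc i) i) ℕₚ.1+n≢n) (if-yes (≡ᵇ-reflects (suc i) (suc i)) refl)

σ-other : ∀ i k → k ≢ i → k ≢ suc i → σ i k ≡ k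
σ-other i k k≢i k≢1+i = ≡.trans (if-no (≡ᵇ-reflects k i) k≢i) (if-no (≡ᵇ-reflects k (suc i)) k≢1+i)

module Quotients {c ℓ} (R : RealNumbers c ℓ) where
  open Positive R

  if-pos : ∀ c {x y} → 0# < x → 0# < y → 0# < (if c then x else y)
  if-pos true  0<x _   = 0<x
  if-pos false _   0<y = 0<y

  prodR-pos : ∀ {A : Set} (h : A → Carrier) → (∀ x → 0# < h x) → ∀ xs → 0# < prodR (map h xs)
  prodR-pos h pos []       = 0<1
  prodR-pos h pos (x ∷ xs) = *-pos (pos x) (prodR-pos h pos xs)

  p-pos : ∀ {a b} (g : P̂ a b → Carrier) → (∀ z → 0# < g z) → ∀ k → 0# < p g k
  p-pos {a} {b} g pos k = if-pos ((k ≡ᵇ 0) ∨ (k ≡ᵇ (a +ⁿ b))) 0<1 (prodR-pos (λ x → g (el x)) (λ x → pos (el x)) (fileElems a b k))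

  module Swap {a b : ℕ} (0<a : 0 <ⁿ a) (0<b : 0 <ⁿ b)
    (f : P̂ a b → Carrier) (pos : ∀ z → 0# < f z) (f0̂ : f 0̂ ≈ 1#) (f1̂ : f 1̂ ≈ 1#)
    (s′ : ℕ) (s<a+b : suc s′ <ⁿ a +ⁿ b) where
    open FileToggle R {a} {b}
    open Diagonals R 0<a 0<b using (key)

    s : ℕ
    s = suc s′

    φf : P̂ a b → Carrier
    φf = φ* s f

    p-elsewhere : ∀ k → k ≢ s → p φf k ≡ p f k
    p-elsewhere k k≢s = p-cong {φf} {f} k (λ x fx → φ*-off s f x (λ e → k≢s (≡.trans (≡.sym fx) e)))

    key-at-s : p φf s * p f s ≈ p f s′ * p f (suc s)
    key-at-s = key f pos f0̂ f1̂ s′ s<a+b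

    Q-at-s : Q φf s ≈ Q f (σ s s)
    Q-at-s = begin
      p φf s * p φf s′ ⁻¹     ≡⟨ cong (λ v → p φf s * v ⁻¹) (p-elsewhere s′ (λ e → ℕₚ.1+n≢n (≡.sym e))) ⟩
      p φf s * p f s′ ⁻¹      ≈⟨ swap-quotients (p-pos f pos s) (p-pos f pos s′) key-at-s ⟩
      p f (suc s) * p f s ⁻¹  ≡⟨ cong (Q f) (≡.sym (σ-at s)) ⟩
      Q f (σ s s)             ∎

    Q-at-s+1 : Q φf (suc s) ≈ Q f (σ s (suc s))
    Q-at-s+1 = begin
      p φf (suc s) * p φf s ⁻¹  ≡⟨ cong (_* p φf s ⁻¹) (p-elsewhere (suc s) ℕₚ.1+n≢n) ⟩
      p f (suc s) * p φf s ⁻¹   ≈⟨ swap-quotients (p-pos f pos s′) 0<p′ (≈-trans (*-comm _ _) (≈-sym key-at-s)) ⟩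
      p f s * p f s′ ⁻¹         ≡⟨ cong (Q f) (≡.sym (σ-next s)) ⟩
      Q f (σ s (suc s))         ∎
      where
      0<p′ : 0# < p φf s
      0<p′ = pos-factor (p-pos f pos s) (pos-resp (≈-sym key-at-s) (*-pos (p-pos f pos s′) (p-pos f pos (suc s))))

    Q-elsewhere : ∀ k → 1 ≤ⁿ k → k ≢ s → k ≢ suc s → Q φf k ≈ Q f (σ s k)
    Q-elsewhere k 1≤k k≢s k≢1+s = begin
      p φf k * p φf (k ∸ 1) ⁻¹  ≡⟨ cong₂ (λ u v → u * v ⁻¹) (p-elsewhere k k≢s) (p-elsewhere (k ∸ 1) k-1≢s) ⟩
      p f k * p f (k ∸ 1) ⁻¹    ≡⟨ cong (Q f) (≡.sym (σ-other s k k≢s k≢1+s)) ⟩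
      Q f (σ s k)               ∎
      where
      k-1≢s : k ∸ 1 ≢ s
      k-1≢s e = k≢1+s (≡.trans (≡.sym (ℕₚ.m+[n∸m]≡n 1≤k)) (cong suc e))

lemma6 : ∀ {c ℓ} (R : RealNumbers c ℓ) → let open Toggling R in
    (a b : ℕ) → 1 ℕ.≤ a → 1 ℕ.≤ b →
    (f : P̂ a b → Carrier) → f 0̂ ≈ 1# → f 1̂ ≈ 1# → (∀ x → 0# < f x) →
    (i : ℕ) → 1 ℕ.≤ i → i ℕ.< a ℕ.+ b →
    (k : ℕ) → 1 ℕ.≤ k → k ℕ.≤ a ℕ.+ b →
    Q (φ* i f) k ≈ Q f (σ i k)
lemma6 R a b 1≤a 1≤b f f0̂ f1̂ pos (suc s′) _ s<n k 1≤k _ = swap k 1≤k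
  where
  open Toggling R
  open Quotients.Swap R 1≤a 1≤b f pos f0̂ f1̂ s′ s<n
  swap : ∀ k → 1 ≤ⁿ k → Q φf k ≈ Q f (σ s k)
  swap k 1≤k with k ℕ.≟ s | k ℕ.≟ suc s
  ... | yes refl | _          = Q-at-s
  ... | no _     | yes refl   = Q-at-s+1
  ... | no k≢s   | no k≢s+1   = Q-elsewhere k 1≤k k≢s k≢s+1
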